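{- Let $\alpha\in\mathfrak S_a$, $\beta\in\mathfrak S_b$ and $\pi=12[\alpha,\beta]$. If $\frac12|L_2(\alpha)|\le\operatorname{diam}(G_\alpha)\le|L_2(\alpha)|$ and $\frac12|L_2(\beta)|\le\operatorname{diam}(G_\beta)\le|L_2(\beta)|$, then $\frac12|L_2(\pi)|\le\operatorname{diam}(G_\pi)\le|L_2(\pi)|$. Moreover, if $\operatorname{diam}(G_\alpha)=|L_2(\alpha)|$ and $\operatorname{diam}(G_\beta)=|L_2(\beta)|$, then $\operatorname{diam}(G_\pi)=|L_2(\pi)|$.
   Context: $12[\alpha,\beta]=\alpha_1\cdots\alpha_a(\beta_1+a)\cdots(\beta_b+a)$. For $\pi\in\mathfrak S_n$, an inversion is a pair $(i,j)$ with $i<j$, $\pi_i>\pi_j$; $I_2(\pi)$ is the set of unordered pairs of disjoint inversions, $I_3(\pi)$ the set of triples of inversions $((i,j),(i,k),(j,k))$ with $i<j<k$ (occurrences of $321$), and $|L_2(\pi)|=|I_2(\pi)|+|I_3(\pi)|$. $R(\pi)$ is the set of reduced words of $\pi$ (minimal-length words $r_1\cdots r_\ell$ in $[n-1]$ with $\pi=s_{r_1}\cdots s_{r_\ell}$, $s_i=(i,i+1)$); $G_\pi$ is the graph on $R(\pi)$ whose edges join words related by one commutation move (exchange adjacent $jk$, $|j-k|>1$) or one long braid move (consecutive $j(j+1)j\leftrightarrow(j+1)j(j+1)$). Diameter = maximum distance between two vertices. -}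

module Defs where

open import Data.Nat as ℕ using (ℕ; zero; suc; pred; _+_; _*_; _≤_; _<_)
open import Data.Fin as F using (Fin; toℕ; inject₁; splitAt; join)
open import Data.Fin.Properties using (_≟_)
open import Data.Fin.Permutation.Components using (transpose)
open import Data.List using (List; []; _∷_; _++_; length; map; concatMap; filter)
open import Data.List.Membership.Propositional using (_∈_)
open import Data.Product using (Σ; _×_; _,_; ∃; ∃-syntax)
open import Data.Sum as Sum using (_⊎_)
open import Function using (_∘_)
open import Function.Definitions using (Injective)
open import Relation.Binary.PropositionalEquality using (_≡_; _≢_)
open import Relation.Nullary using (¬_)
open import Relation.Nullary.Decidable using (_×-dec_; ¬?)
open import Data.Fin.Properties using (_<?_)

-- Permutations of [n] in one-line notation: π : Fin n → Fin n with
-- π i = π_{i+1} (positions and values shifted to be 0-indexed),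
-- required to be injective (hence bijective).

Perm : ℕ → Set
Perm n = Fin n → Fin n

IsPerm : ∀ {n} → Perm n → Set
IsPerm π = Injective _≡_ _≡_ π

dsum : ∀ {a b} → Perm a → Perm b → Perm (a + b)
dsum {a} {b} α β = join a b ∘ Sum.map α β ∘ splitAt a

-- Words.  A letter j : Fin (pred n) stands for the paper's letter
-- toℕ j + 1 ∈ [n-1], i.e. the simple transposition exchanging the
-- (0-indexed) positions j and j+1.

record Letter (n : ℕ) : Set where
  constructor letter
  field idx : Fin (pred n)
open Letter public

Word : ℕ → Set
Word n = List (Letter n)

s : ∀ {n} → Letter n → Perm n
s {suc m} (letter j) = transpose (inject₁ j) (F.suc j)

eval : ∀ {n} → Word n → Perm n
eval []      i = i
eval (r ∷ w) i = s r (eval w i)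

IsReduced : ∀ {n} → Perm n → Word n → Set
IsReduced {n} π w =
  (∀ i → eval w i ≡ π i) × (∀ (w' : Word n) → (∀ i → eval w' i ≡ π i) → length w ≤ length w')

data Move {n : ℕ} : Word n → Word n → Set where
  commute : ∀ (u v : Word n) (j k : Letter n) →
            suc (toℕ (idx j)) < toℕ (idx k) ⊎ suc (toℕ (idx k)) < toℕ (idx j) →
            Move (u ++ j ∷ k ∷ v) (u ++ k ∷ j ∷ v)
  braid   : ∀ (u v : Word n) (j k : Letter n) → toℕ (idx k) ≡ suc (toℕ (idx j)) →
            Move (u ++ j ∷ k ∷ j ∷ v) (u ++ k ∷ j ∷ k ∷ v)

Adj : ∀ {n} → Word n → Word n → Set
Adj w w' = Move w w' ⊎ Move w' w

-- Walk w w' k : a walk of length k from w to w' (moves preserve the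
-- product and the length, so walks between reduced words of π stay in R(π))
data Walk {n : ℕ} : Word n → Word n → ℕ → Set where
  here : ∀ {w} → Walk w w 0
  step : ∀ {w u w' k} → Adj w u → Walk u w' k → Walk w w' (suc k)

IsDiam : ∀ {n} → Perm n → ℕ → Set
IsDiam {n} π d =
  (∀ (w w' : Word n) → IsReduced π w → IsReduced π w' →
     ∃[ k ] (k ≤ d × Walk w w' k))
  × (∃[ w ] ∃[ w' ] (IsReduced π w × IsReduced π w' ×
       (∀ k → Walk w w' k → d ≤ k)))

allFin : ∀ n → List (Fin n)
allFin n = Data.List.allFin n
  where import Data.List

pairs : ∀ n → List (Fin n × Fin n)
pairs n = concatMap (λ i → map (i ,_) (allFin n)) (allFin n)

triples : ∀ n → List (Fin n × Fin n × Fin n)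
triples n = concatMap (λ i → map (i ,_) (pairs n)) (allFin n)

Inv : ∀ {n} → Perm n → List (Fin n × Fin n)
Inv π = filter (λ { (i , j) → (i <? j) ×-dec (π j <? π i) }) (pairs _)

unorderedPairs : ∀ {A : Set} → List A → List (A × A)
unorderedPairs []       = []
unorderedPairs (x ∷ xs) = map (x ,_) xs ++ unorderedPairs xs

I2 : ∀ {n} → Perm n → List ((Fin n × Fin n) × (Fin n × Fin n))
I2 π = filter (λ { ((i , j) , (k , l)) →
                 ¬? (i ≟ k) ×-dec ¬? (i ≟ l) ×-dec ¬? (j ≟ k) ×-dec ¬? (j ≟ l) })
              (unorderedPairs (Inv π))

I3 : ∀ {n} → Perm n → List (Fin n × Fin n × Fin n)
I3 π = filter (λ { (i , j , k) → (i <? j) ×-dec (j <? k) ×-dec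
                                 (π j <? π i) ×-dec (π k <? π j) })
              (triples _)

L2size : ∀ {n} → Perm n → ℕ
L2size π = length (I2 π) + length (I3 π)

-- The length ℓ(τ) of the reduced words of τ is its number of inversions: a
-- simple transposition changes the inversion number by exactly one, and
-- bubble sort attains it.  For π = 12[α,β] this gives ℓ(π) = ℓ(α) + ℓ(β), so
-- no reduced word of π uses the letter a joining the two blocks, and the
-- reduced words of π are the shuffles of reduced words of α and of the
-- shifted β.  Seen in the two blocks, a move of G_π is a move of G_α, a move
-- of G_β, or the commutation of a letter of α with a letter of β, which
-- changes by one the number of letters of β standing before letters of α.
-- With (uα, uα′) and (uβ, uβ′) diametral pairs, a walk from uα uβ to uβ′ uα′
-- must create all ℓ(α)ℓ(β) such pairs, so diam G_π ≥ diam G_α + diam G_β +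
-- ℓ(α)ℓ(β); sorting two reduced words into the cheaper of the two block
-- orders shows equality.  On the other side |L₂(π)| = |L₂(α)| + |L₂(β)| +
-- ℓ(α)ℓ(β): a pair of disjoint inversions lies in one block or takes one
-- inversion from each, and no 321-pattern meets both blocks.  The bounds then
-- add up.

module Submission where

open import Defs
import Data.Nat.Properties as ℕₚ
open import Algebra.Properties.CommutativeMonoid.Sum ℕₚ.+-0-commutativeMonoid
  using (sum; sum-syntax; sum-cong-≗; sum-remove; sum-replicate-zero)
open import Data.Bool using (Bool; true; false; _∧_; not; T; if_then_else_)
open import Data.Bool.Properties using (∧-zeroʳ; ∧-identityʳ)
open import Data.Empty using (⊥-elim)
open import Data.List using (List; []; _∷_; _++_; [_]; length; map; reverse; filter; tabulate; concatMap)
open import Data.List.Relation.Unary.All using (All; []; _∷_)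
import Data.List.Relation.Unary.All.Properties as Allₚ
import Data.List.Properties as Listₚ
open import Data.Fin as Fin using (Fin; toℕ; inject₁; fromℕ<; _↑ˡ_; _↑ʳ_; punchIn; punchOut)
import Data.Fin.Properties as Finₚ
open import Data.Nat using (ℕ; zero; suc; pred; _+_; _*_; _∸_; _≤_; _<_; _<ᵇ_; _≡ᵇ_; z≤n; s≤s)
open import Data.Nat.Solver using (module +-*-Solver)
open import Data.Product using (Σ; _×_; _,_; proj₁; proj₂; ∃-syntax)
import Data.Product as Prod
open import Data.Sum using (_⊎_; inj₁; inj₂)
open import Data.Unit using (tt)
open import Function using (_∘_)
open import Relation.Binary.PropositionalEquality hiding ([_])
open import Relation.Binary.Definitions using (tri<; tri≈; tri>)
open import Relation.Nullary using (¬_; Dec; yes; no; does)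
open import Relation.Nullary.Decidable using (dec-true; dec-false)
open import Relation.Unary using (Pred; Decidable)
open import Level using (0ℓ)

open +-*-Solver

indicator : Bool → ℕ
indicator true  = 1
indicator false = 0

indicator≤1 : ∀ b → indicator b ≤ 1
indicator≤1 true  = s≤s z≤n
indicator≤1 false = z≤n

<⇒<ᵇ≡true : ∀ {m n} → m < n → (m <ᵇ n) ≡ true
<⇒<ᵇ≡true {m} {n} m<n with m <ᵇ n | ℕₚ.<⇒<ᵇ m<n
... | true | _ = refl

≮⇒<ᵇ≡false : ∀ {m n} → ¬ m < n → (m <ᵇ n) ≡ false
≮⇒<ᵇ≡false {m} {n} m≮n with m <ᵇ n in eq
... | true  = ⊥-elim (m≮n (ℕₚ.<ᵇ⇒< m n (subst T (sym eq) tt)))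
... | false = refl

<ᵇ-cong : ∀ {m n m′ n′} → (m < n → m′ < n′) → (m′ < n′ → m < n) → (m <ᵇ n) ≡ (m′ <ᵇ n′)
<ᵇ-cong {m} {n} to from with m ℕₚ.<? n
... | yes m<n = trans (<⇒<ᵇ≡true m<n) (sym (<⇒<ᵇ≡true (to m<n)))
... | no  m≮n = trans (≮⇒<ᵇ≡false m≮n) (sym (≮⇒<ᵇ≡false (m≮n ∘ from)))

≢⇒≡ᵇ≡false : ∀ {m n} → m ≢ n → (m ≡ᵇ n) ≡ false
≢⇒≡ᵇ≡false {m} {n} m≢n with m ≡ᵇ n in eq
... | true  = ⊥-elim (m≢n (ℕₚ.≡ᵇ⇒≡ m n (subst T (sym eq) tt)))
... | false = refl

≡ᵇ-refl : ∀ n → (n ≡ᵇ n) ≡ true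
≡ᵇ-refl zero    = refl
≡ᵇ-refl (suc n) = ≡ᵇ-refl n

+-<ᵇ-cancelˡ : ∀ k m n → (k + m <ᵇ k + n) ≡ (m <ᵇ n)
+-<ᵇ-cancelˡ zero    m n = refl
+-<ᵇ-cancelˡ (suc k) m n = +-<ᵇ-cancelˡ k m n

sum-zero : ∀ {n} {f : Fin n → ℕ} → (∀ i → f i ≡ 0) → sum f ≡ 0
sum-zero {n} f≗0 = trans (sum-cong-≗ f≗0) (sum-replicate-zero n)

sum-↑ : ∀ a b (f : Fin (a + b) → ℕ) →
        sum f ≡ sum (λ i → f (i ↑ˡ b)) + sum (λ k → f (a ↑ʳ k))
sum-↑ zero    b f = refl
sum-↑ (suc a) b f = trans (cong (f Fin.zero +_) (sum-↑ a b (f ∘ Fin.suc)))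
                          (sym (ℕₚ.+-assoc (f Fin.zero) _ _))

sum-↑ˡ : ∀ a b (f : Fin (a + b) → ℕ) → (∀ k → f (a ↑ʳ k) ≡ 0) → sum f ≡ sum (λ i → f (i ↑ˡ b))
sum-↑ˡ a b f f≡0 = trans (sum-↑ a b f) (trans (cong (sum (λ i → f (i ↑ˡ b)) +_) (sum-zero f≡0)) (ℕₚ.+-identityʳ _))

sum-↑ʳ : ∀ a b (f : Fin (a + b) → ℕ) → (∀ i → f (i ↑ˡ b) ≡ 0) → sum f ≡ sum (λ k → f (a ↑ʳ k))
sum-↑ʳ a b f f≡0 = trans (sum-↑ a b f) (cong (_+ sum (λ k → f (a ↑ʳ k))) (sum-zero f≡0))

sum-agreeOff : ∀ {n} (f g : Fin n → ℕ) x → (∀ i → i ≢ x → f i ≡ g i) →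
               sum f + g x ≡ sum g + f x
sum-agreeOff {suc n} f g x agree = begin
  sum f + g x                           ≡⟨ cong (_+ g x) (sum-remove {i = x} f) ⟩
  f x + sum (f ∘ punchIn x) + g x       ≡⟨ cong (λ r → f x + r + g x) rest ⟩
  f x + sum (g ∘ punchIn x) + g x       ≡⟨ solve 3 (λ u v r → u :+ r :+ v := v :+ r :+ u) refl (f x) (g x) _ ⟩
  g x + sum (g ∘ punchIn x) + f x       ≡⟨ cong (_+ f x) (sum-remove {i = x} g) ⟨
  sum g + f x                           ∎
  where
  open ≡-Reasoning
  rest : sum (f ∘ punchIn x) ≡ sum (g ∘ punchIn x)
  rest = sum-cong-≗ (λ j → agree (punchIn x j) (Finₚ.punchInᵢ≢i x j))

sum-agreeOff₂ : ∀ {n} (f g : Fin n → ℕ) {x y} → x ≢ y →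
                (∀ i → i ≢ x → i ≢ y → f i ≡ g i) →
                sum f + g x + g y ≡ sum g + f x + f y
sum-agreeOff₂ {suc n} f g {x} {y} x≢y agree = begin
  sum f + g x + g y                  ≡⟨ cong (λ r → r + g x + g y) (sum-remove {i = x} f) ⟩
  f x + sum f′ + g x + g y           ≡⟨ solve 4 (λ u v w r → u :+ r :+ v :+ w := v :+ (r :+ w) :+ u) refl (f x) (g x) (g y) _ ⟩
  g x + (sum f′ + g y) + f x         ≡⟨ cong (λ r → g x + r + f x) rest ⟩
  g x + (sum g′ + f y) + f x         ≡⟨ solve 4 (λ u v w r → v :+ (r :+ w) :+ u := v :+ r :+ u :+ w) refl (f x) (g x) (f y) _ ⟩
  g x + sum g′ + f x + f y           ≡⟨ cong (λ r → r + f x + f y) (sum-remove {i = x} g) ⟨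
  sum g + f x + f y                  ∎
  where
  open ≡-Reasoning
  f′ g′ : Fin n → ℕ
  f′ = f ∘ punchIn x
  g′ = g ∘ punchIn x
  y′ = punchOut x≢y
  x↑y′ : punchIn x y′ ≡ y
  x↑y′ = Finₚ.punchIn-punchOut x≢y
  rest : sum f′ + g y ≡ sum g′ + f y
  rest = subst₂ (λ u v → sum f′ + u ≡ sum g′ + v) (cong g x↑y′) (cong f x↑y′)
    (sum-agreeOff f′ g′ y′ (λ j j≢y′ → agree (punchIn x j) (Finₚ.punchInᵢ≢i x j)
      (λ e → j≢y′ (Finₚ.punchIn-injective x j y′ (trans e (sym x↑y′))))))

-- The inversion number

swapℕ : ℕ → ℕ → ℕ
swapℕ j t = if t ≡ᵇ j then suc j else if t ≡ᵇ suc j then j else t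

swapℕ-low : ∀ j → swapℕ j j ≡ suc j
swapℕ-low j rewrite ≡ᵇ-refl j = refl

swapℕ-high : ∀ j → swapℕ j (suc j) ≡ j
swapℕ-high j rewrite ≢⇒≡ᵇ≡false (ℕₚ.1+n≢n {j}) | ≡ᵇ-refl j = refl

swapℕ-other : ∀ {j t} → t ≢ j → t ≢ suc j → swapℕ j t ≡ t
swapℕ-other t≢j t≢1+j rewrite ≢⇒≡ᵇ≡false t≢j | ≢⇒≡ᵇ≡false t≢1+j = refl

swapℕ-involutive : ∀ j t → swapℕ j (swapℕ j t) ≡ t
swapℕ-involutive j t with t ℕₚ.≟ j | t ℕₚ.≟ suc j
... | yes refl | _        rewrite swapℕ-low t  = swapℕ-high t
... | no _     | yes refl rewrite swapℕ-high j = swapℕ-low j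
... | no t≢j   | no t≢1+j rewrite swapℕ-other t≢j t≢1+j = swapℕ-other t≢j t≢1+j

swapℕ-+ : ∀ a j t → swapℕ (a + j) (a + t) ≡ a + swapℕ j t
swapℕ-+ a j t with t ℕₚ.≟ j | t ℕₚ.≟ suc j
... | yes refl | _ rewrite swapℕ-low (a + t) | swapℕ-low t = sym (ℕₚ.+-suc a t)
... | no _ | yes refl = trans (cong (swapℕ (a + j)) (ℕₚ.+-suc a j))
                              (trans (swapℕ-high (a + j)) (cong (a +_) (sym (swapℕ-high j))))
... | no t≢j | no t≢1+j rewrite swapℕ-other t≢j t≢1+j =
  swapℕ-other (t≢j ∘ ℕₚ.+-cancelˡ-≡ a t j)
              (t≢1+j ∘ ℕₚ.+-cancelˡ-≡ a t (suc j) ∘ (λ e → trans e (sym (ℕₚ.+-suc a j))))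

private
  <ᵇ-suc : ∀ {u j} → u ≢ j → (u <ᵇ suc j) ≡ (u <ᵇ j)
  <ᵇ-suc u≢j = <ᵇ-cong (λ u<1+j → ℕₚ.≤∧≢⇒< (ℕₚ.≤-pred u<1+j) u≢j) ℕₚ.m<n⇒m<1+n

  suc-<ᵇ : ∀ {t j} → t ≢ suc j → (suc j <ᵇ t) ≡ (j <ᵇ t)
  suc-<ᵇ {j = j} t≢1+j = <ᵇ-cong (ℕₚ.<-trans (ℕₚ.n<1+n j)) (λ j<t → ℕₚ.≤∧≢⇒< j<t (t≢1+j ∘ sym))

swapℕ-<ᵇ : ∀ j t u → ¬ (t ≡ j × u ≡ suc j) → ¬ (t ≡ suc j × u ≡ j) →
           (swapℕ j u <ᵇ swapℕ j t) ≡ (u <ᵇ t)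
swapℕ-<ᵇ j t u ¬lh ¬hl with t ℕₚ.≟ j | t ℕₚ.≟ suc j | u ℕₚ.≟ j | u ℕₚ.≟ suc j
... | yes refl | _        | yes refl | _        = cong₂ _<ᵇ_ (swapℕ-low j) (swapℕ-low j)
... | yes refl | _        | no _     | yes u≡1+j = ⊥-elim (¬lh (refl , u≡1+j))
... | yes refl | _        | no u≢j   | no u≢1+j rewrite swapℕ-low t | swapℕ-other u≢j u≢1+j = <ᵇ-suc u≢j
... | no _     | yes refl | yes u≡j  | _        = ⊥-elim (¬hl (refl , u≡j))
... | no _     | yes refl | no _     | yes refl = cong₂ _<ᵇ_ (swapℕ-high j) (swapℕ-high j)
... | no _     | yes refl | no u≢j   | no u≢1+j rewrite swapℕ-high j | swapℕ-other u≢j u≢1+j = sym (<ᵇ-suc u≢j)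
... | no t≢j   | no t≢1+j | yes refl | _        rewrite swapℕ-low u | swapℕ-other t≢j t≢1+j = suc-<ᵇ t≢1+j
... | no t≢j   | no t≢1+j | no _     | yes refl rewrite swapℕ-high j | swapℕ-other t≢j t≢1+j = sym (suc-<ᵇ t≢1+j)
... | no t≢j   | no t≢1+j | no u≢j   | no u≢1+j rewrite swapℕ-other t≢j t≢1+j | swapℕ-other u≢j u≢1+j = refl

low high : ∀ {n} → Letter n → Fin n
low  {suc _} (letter j) = inject₁ j
high {suc _} (letter j) = Fin.suc j

toℕ-low : ∀ {n} (l : Letter n) → toℕ (low l) ≡ toℕ (idx l)
toℕ-low {suc _} (letter j) = Finₚ.toℕ-inject₁ j

toℕ-high : ∀ {n} (l : Letter n) → toℕ (high l) ≡ suc (toℕ (idx l))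
toℕ-high {suc _} (letter j) = refl

letter-≡ : ∀ {n} {l l′ : Letter n} → toℕ (idx l) ≡ toℕ (idx l′) → l ≡ l′
letter-≡ {l = letter _} {letter _} e = cong letter (Finₚ.toℕ-injective e)

toℕ-s : ∀ {n} (l : Letter n) i → toℕ (s l i) ≡ swapℕ (toℕ (idx l)) (toℕ i)
toℕ-s {suc _} (letter j) i with i Finₚ.≟ inject₁ j
... | yes refl rewrite Finₚ.toℕ-inject₁ j = sym (swapℕ-low (toℕ j))
... | no i≢low with i Finₚ.≟ Fin.suc j
...   | yes refl = trans (Finₚ.toℕ-inject₁ j) (sym (swapℕ-high (toℕ j)))
...   | no i≢high = sym (swapℕ-other (i≢low ∘ Finₚ.toℕ-injective ∘ (λ e → trans e (sym (Finₚ.toℕ-inject₁ j))))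
                                    (i≢high ∘ Finₚ.toℕ-injective))

s-involutive : ∀ {n} (l : Letter n) i → s l (s l i) ≡ i
s-involutive l i = Finₚ.toℕ-injective (begin
  toℕ (s l (s l i))                                    ≡⟨ toℕ-s l (s l i) ⟩
  swapℕ (toℕ (idx l)) (toℕ (s l i))                    ≡⟨ cong (swapℕ _) (toℕ-s l i) ⟩
  swapℕ (toℕ (idx l)) (swapℕ (toℕ (idx l)) (toℕ i))    ≡⟨ swapℕ-involutive _ _ ⟩
  toℕ i                                                ∎)
  where open ≡-Reasoning

isInversion : ∀ {n} → Perm n → Fin n → Fin n → Bool
isInversion τ i k = (toℕ i <ᵇ toℕ k) ∧ (toℕ (τ k) <ᵇ toℕ (τ i))

inversionAt : ∀ {n} → Perm n → Fin n → Fin n → ℕ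
inversionAt τ i k = indicator (isInversion τ i k)

inversions : ∀ {n} → Perm n → ℕ
inversions {n} τ = ∑[ i < n ] ∑[ k < n ] inversionAt τ i k

inversions-cong : ∀ {n} {τ τ′ : Perm n} → (∀ i → τ i ≡ τ′ i) → inversions τ ≡ inversions τ′
inversions-cong τ≗τ′ = sum-cong-≗ (λ i → sum-cong-≗ (λ k →
  cong₂ (λ u v → indicator (_ ∧ (toℕ u <ᵇ toℕ v))) (τ≗τ′ k) (τ≗τ′ i)))

-- Only the pair of positions p, q holding the two exchanged values changes status.
module _ {n} (τ : Perm n) (τ-inj : IsPerm τ) (l : Letter n) {p q : Fin n}
         (τp : τ p ≡ low l) (τq : τ q ≡ high l) where

  private
    j = toℕ (idx l)
    σ : Perm n
    σ = s l ∘ τ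

    τp′ : toℕ (τ p) ≡ j
    τp′ = trans (cong toℕ τp) (toℕ-low l)
    τq′ : toℕ (τ q) ≡ suc j
    τq′ = trans (cong toℕ τq) (toℕ-high l)

    at-p : ∀ {x} → toℕ (τ x) ≡ j → x ≡ p
    at-p e = τ-inj (Finₚ.toℕ-injective (trans e (sym τp′)))
    at-q : ∀ {x} → toℕ (τ x) ≡ suc j → x ≡ q
    at-q e = τ-inj (Finₚ.toℕ-injective (trans e (sym τq′)))

    p≢q : p ≢ q
    p≢q refl = ℕₚ.1+n≢n (trans (sym τq′) τp′)

    j<ᵇ1+j : (j <ᵇ suc j) ≡ true
    j<ᵇ1+j = <⇒<ᵇ≡true (ℕₚ.n<1+n j)
    1+j<ᵇj : (suc j <ᵇ j) ≡ false
    1+j<ᵇj = ≮⇒<ᵇ≡false (ℕₚ.<-asym (ℕₚ.n<1+n j))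

    σ-inversionAt : ∀ i k → inversionAt σ i k ≡
                    indicator ((toℕ i <ᵇ toℕ k) ∧ (swapℕ j (toℕ (τ k)) <ᵇ swapℕ j (toℕ (τ i))))
    σ-inversionAt i k rewrite toℕ-s l (τ k) | toℕ-s l (τ i) = refl

    unchanged : ∀ i k → ¬ (i ≡ p × k ≡ q) → ¬ (i ≡ q × k ≡ p) → inversionAt σ i k ≡ inversionAt τ i k
    unchanged i k ¬pq ¬qp rewrite σ-inversionAt i k
      | swapℕ-<ᵇ j (toℕ (τ i)) (toℕ (τ k))
          (λ { (e₁ , e₂) → ¬pq (at-p e₁ , at-q e₂) }) (λ { (e₁ , e₂) → ¬qp (at-q e₁ , at-p e₂) }) = refl

    σ-pq : inversionAt σ p q ≡ indicator (toℕ p <ᵇ toℕ q)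
    σ-pq rewrite σ-inversionAt p q | τp′ | τq′ | swapℕ-low j | swapℕ-high j | j<ᵇ1+j
      | ∧-identityʳ (toℕ p <ᵇ toℕ q) = refl
    τ-pq : inversionAt τ p q ≡ 0
    τ-pq rewrite τp′ | τq′ | 1+j<ᵇj | ∧-zeroʳ (toℕ p <ᵇ toℕ q) = refl
    σ-qp : inversionAt σ q p ≡ 0
    σ-qp rewrite σ-inversionAt q p | τp′ | τq′ | swapℕ-low j | swapℕ-high j | 1+j<ᵇj
      | ∧-zeroʳ (toℕ q <ᵇ toℕ p) = refl
    τ-qp : inversionAt τ q p ≡ indicator (toℕ q <ᵇ toℕ p)
    τ-qp rewrite τp′ | τq′ | j<ᵇ1+j | ∧-identityʳ (toℕ q <ᵇ toℕ p) = refl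

    rowσ rowτ : Fin n → ℕ
    rowσ i = sum (inversionAt σ i)
    rowτ i = sum (inversionAt τ i)

    row-p : rowσ p ≡ rowτ p + indicator (toℕ p <ᵇ toℕ q)
    row-p = begin
      rowσ p                   ≡⟨ ℕₚ.+-identityʳ _ ⟨
      rowσ p + 0               ≡⟨ cong (rowσ p +_) τ-pq ⟨
      rowσ p + inversionAt τ p q ≡⟨ sum-agreeOff (inversionAt σ p) (inversionAt τ p) q
                                      (λ k k≢q → unchanged p k (k≢q ∘ proj₂) (p≢q ∘ proj₁)) ⟩
      rowτ p + inversionAt σ p q ≡⟨ cong (rowτ p +_) σ-pq ⟩
      rowτ p + indicator (toℕ p <ᵇ toℕ q) ∎
      where open ≡-Reasoning

    row-q : rowσ q + indicator (toℕ q <ᵇ toℕ p) ≡ rowτ q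
    row-q = begin
      rowσ q + indicator (toℕ q <ᵇ toℕ p) ≡⟨ cong (rowσ q +_) τ-qp ⟨
      rowσ q + inversionAt τ q p ≡⟨ sum-agreeOff (inversionAt σ q) (inversionAt τ q) p
                                      (λ k k≢p → unchanged q k (p≢q ∘ sym ∘ proj₁) (k≢p ∘ proj₂)) ⟩
      rowτ q + inversionAt σ q p ≡⟨ cong (rowτ q +_) σ-qp ⟩
      rowτ q + 0                 ≡⟨ ℕₚ.+-identityʳ _ ⟩
      rowτ q                     ∎
      where open ≡-Reasoning

    row-other : ∀ i → i ≢ p → i ≢ q → rowσ i ≡ rowτ i
    row-other i i≢p i≢q = sum-cong-≗ (λ k → unchanged i k (i≢p ∘ proj₁) (i≢q ∘ proj₁))

  inversions-s∘ : inversions (s l ∘ τ) + indicator (toℕ q <ᵇ toℕ p) ≡ inversions τ + indicator (toℕ p <ᵇ toℕ q)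
  inversions-s∘ = ℕₚ.+-cancelʳ-≡ (rowτ p + rowτ q) _ _ (begin
    sum rowσ + [q<p] + (rowτ p + rowτ q)      ≡⟨ solve 4 (λ S c x y → S :+ c :+ (x :+ y) := S :+ x :+ y :+ c) refl (sum rowσ) [q<p] (rowτ p) (rowτ q) ⟩
    sum rowσ + rowτ p + rowτ q + [q<p]        ≡⟨ cong (_+ [q<p]) (sum-agreeOff₂ rowσ rowτ p≢q row-other) ⟩
    sum rowτ + rowσ p + rowσ q + [q<p]        ≡⟨ cong (λ r → sum rowτ + r + rowσ q + [q<p]) row-p ⟩
    sum rowτ + (rowτ p + [p<q]) + rowσ q + [q<p] ≡⟨ solve 5 (λ S x c y d → S :+ (x :+ c) :+ y :+ d := S :+ c :+ x :+ (y :+ d)) refl (sum rowτ) (rowτ p) [p<q] (rowσ q) [q<p] ⟩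
    sum rowτ + [p<q] + rowτ p + (rowσ q + [q<p]) ≡⟨ cong (sum rowτ + [p<q] + rowτ p +_) row-q ⟩
    sum rowτ + [p<q] + rowτ p + rowτ q        ≡⟨ ℕₚ.+-assoc (sum rowτ + [p<q]) (rowτ p) (rowτ q) ⟩
    sum rowτ + [p<q] + (rowτ p + rowτ q)      ∎)
    where
    open ≡-Reasoning
    [q<p] = indicator (toℕ q <ᵇ toℕ p)
    [p<q] = indicator (toℕ p <ᵇ toℕ q)

-- Length of reduced words

All-reverse : ∀ {A : Set} {P : A → Set} {xs} → All P xs → All P (reverse xs)
All-reverse []                 = []
All-reverse {xs = x ∷ xs} (px ∷ pxs) = subst (All _) (sym (Listₚ.unfold-reverse x xs)) (Allₚ.∷ʳ⁺ (All-reverse pxs) px)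

retraction⇒injective : ∀ {n} {τ : Perm n} ρ → (∀ i → ρ (τ i) ≡ i) → IsPerm τ
retraction⇒injective ρ ρτ {i} {k} e = trans (sym (ρτ i)) (trans (cong ρ e) (ρτ k))

eval-++ : ∀ {n} (u v : Word n) i → eval (u ++ v) i ≡ eval u (eval v i)
eval-++ []      v i = refl
eval-++ (l ∷ u) v i = cong (s l) (eval-++ u v i)

eval-reverse∘eval : ∀ {n} (w : Word n) i → eval (reverse w) (eval w i) ≡ i
eval-reverse∘eval []      i = refl
eval-reverse∘eval (l ∷ w) i = begin
  eval (reverse (l ∷ w)) (s l (eval w i))     ≡⟨ cong (λ u → eval u (s l (eval w i))) (Listₚ.unfold-reverse l w) ⟩
  eval (reverse w ++ [ l ]) (s l (eval w i))  ≡⟨ eval-++ (reverse w) [ l ] _ ⟩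
  eval (reverse w) (s l (s l (eval w i)))     ≡⟨ cong (eval (reverse w)) (s-involutive l _) ⟩
  eval (reverse w) (eval w i)                 ≡⟨ eval-reverse∘eval w i ⟩
  i                                           ∎
  where open ≡-Reasoning

eval∘eval-reverse : ∀ {n} (w : Word n) i → eval w (eval (reverse w) i) ≡ i
eval∘eval-reverse []      i = refl
eval∘eval-reverse (l ∷ w) i = begin
  s l (eval w (eval (reverse (l ∷ w)) i))     ≡⟨ cong (λ u → s l (eval w (eval u i))) (Listₚ.unfold-reverse l w) ⟩
  s l (eval w (eval (reverse w ++ [ l ]) i))  ≡⟨ cong (s l ∘ eval w) (eval-++ (reverse w) [ l ] i) ⟩
  s l (eval w (eval (reverse w) (s l i)))     ≡⟨ cong (s l) (eval∘eval-reverse w (s l i)) ⟩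
  s l (s l i)                                 ≡⟨ s-involutive l i ⟩
  i                                           ∎
  where open ≡-Reasoning

inversions-∷ : ∀ {n} (l : Letter n) (w : Word n) → inversions (eval (l ∷ w)) ≤ suc (inversions (eval w))
inversions-∷ l w = begin
  inversions (eval (l ∷ w))                       ≤⟨ ℕₚ.m≤m+n _ _ ⟩
  inversions (s l ∘ eval w) + indicator _         ≡⟨ inversions-s∘ (eval w) (retraction⇒injective (eval (reverse w)) (eval-reverse∘eval w)) l
                                                       (eval∘eval-reverse w (low l)) (eval∘eval-reverse w (high l)) ⟩
  inversions (eval w) + indicator _               ≤⟨ ℕₚ.+-monoʳ-≤ (inversions (eval w)) (indicator≤1 _) ⟩
  inversions (eval w) + 1                         ≡⟨ ℕₚ.+-comm _ 1 ⟩
  suc (inversions (eval w))                       ∎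
  where open ℕₚ.≤-Reasoning

inversions≤length : ∀ {n} (w : Word n) → inversions (eval w) ≤ length w
inversions≤length {n} [] = ℕₚ.≤-reflexive (sum-zero (λ i → sum-zero (λ k → no-inversion i k)))
  where
  no-inversion : (i k : Fin n) → inversionAt (λ x → x) i k ≡ 0
  no-inversion i k with toℕ i <ᵇ toℕ k in i<k
  ... | false = refl
  ... | true  = cong indicator (≮⇒<ᵇ≡false (ℕₚ.<-asym (ℕₚ.<ᵇ⇒< (toℕ i) (toℕ k) (subst T (sym i<k) tt))))
inversions≤length (l ∷ w) = ℕₚ.≤-trans (inversions-∷ l w) (s≤s (inversions≤length w))

module _ {n} (ρ : Perm n) (ascending : ∀ x y → toℕ y ≡ suc (toℕ x) → toℕ (ρ x) < toℕ (ρ y)) where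

  private
    above : ∀ m (x : Fin n) → toℕ x ≡ m → m ≤ toℕ (ρ x)
    above zero    x _   = z≤n
    above (suc m) x x≡1+m = ℕₚ.<-≤-trans (s≤s (above m x′ x′≡m)) (ascending x′ x (trans x≡1+m (cong suc (sym x′≡m))))
      where
      m<n : m < n
      m<n = ℕₚ.<-trans (ℕₚ.≤-reflexive (sym x≡1+m)) (Finₚ.toℕ<n x)
      x′ = fromℕ< m<n
      x′≡m = Finₚ.toℕ-fromℕ< m<n

    below : ∀ m (x : Fin n) → toℕ x + suc m ≡ n → toℕ (ρ x) + suc m ≤ n
    below zero    x _ = ℕₚ.≤-trans (ℕₚ.≤-reflexive (ℕₚ.+-comm _ 1)) (Finₚ.toℕ<n (ρ x))
    below (suc m) x x+2+m≡n = begin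
      toℕ (ρ x) + suc (suc m)   ≡⟨ ℕₚ.+-suc (toℕ (ρ x)) (suc m) ⟩
      suc (toℕ (ρ x)) + suc m   ≤⟨ ℕₚ.+-monoˡ-≤ (suc m) (ascending x x″ x″≡1+x) ⟩
      toℕ (ρ x″) + suc m        ≤⟨ below m x″ (trans (cong (_+ suc m) x″≡1+x) (trans (sym (ℕₚ.+-suc (toℕ x) (suc m))) x+2+m≡n)) ⟩
      n                         ∎
      where
      open ℕₚ.≤-Reasoning
      1+x<n : suc (toℕ x) < n
      1+x<n = ℕₚ.≤-trans (ℕₚ.≤-trans (ℕₚ.≤-reflexive (ℕₚ.+-comm 2 (toℕ x)))
                (ℕₚ.+-monoʳ-≤ (toℕ x) (s≤s (s≤s (z≤n {m}))))) (ℕₚ.≤-reflexive x+2+m≡n)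
      x″ = fromℕ< 1+x<n
      x″≡1+x = Finₚ.toℕ-fromℕ< 1+x<n

  ascending⇒identity : ∀ x → ρ x ≡ x
  ascending⇒identity x = Finₚ.toℕ-injective (ℕₚ.≤-antisym ρx≤x (above (toℕ x) x refl))
    where
    m = n ∸ suc (toℕ x)
    x+1+m≡n : toℕ x + suc m ≡ n
    x+1+m≡n = trans (ℕₚ.+-suc (toℕ x) m) (ℕₚ.m+[n∸m]≡n (Finₚ.toℕ<n x))
    ρx≤x : toℕ (ρ x) ≤ toℕ x
    ρx≤x = ℕₚ.+-cancelʳ-≤ (suc m) _ _ (ℕₚ.≤-trans (below m x x+1+m≡n) (ℕₚ.≤-reflexive (sym x+1+m≡n)))

letterBetween : ∀ {n} (x y : Fin n) → toℕ y ≡ suc (toℕ x) → Σ (Letter n) λ l → low l ≡ x × high l ≡ y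
letterBetween {suc m} x y y≡1+x =
  letter j , Finₚ.toℕ-injective (trans (Finₚ.toℕ-inject₁ j) j≡x) , Finₚ.toℕ-injective (trans (cong suc j≡x) (sym y≡1+x))
  where
  x<m : toℕ x < m
  x<m = ℕₚ.≤-pred (ℕₚ.≤-trans (ℕₚ.≤-reflexive (cong suc (sym y≡1+x))) (Finₚ.toℕ<n y))
  j = fromℕ< x<m
  j≡x = Finₚ.toℕ-fromℕ< x<m

module _ {n} (τ ρ : Perm n) (τ∘ρ : ∀ v → τ (ρ v) ≡ v) (ρ∘τ : ∀ i → ρ (τ i) ≡ i) (l : Letter n) where

  private
    exchange : inversions (s l ∘ τ) + indicator (toℕ (ρ (high l)) <ᵇ toℕ (ρ (low l)))
             ≡ inversions τ + indicator (toℕ (ρ (low l)) <ᵇ toℕ (ρ (high l)))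
    exchange = inversions-s∘ τ (retraction⇒injective ρ ρ∘τ) l (τ∘ρ (low l)) (τ∘ρ (high l))

  inversions-s∘-ascent : toℕ (ρ (low l)) < toℕ (ρ (high l)) → inversions (s l ∘ τ) ≡ suc (inversions τ)
  inversions-s∘-ascent asc = begin
    inversions (s l ∘ τ)                                          ≡⟨ ℕₚ.+-identityʳ _ ⟨
    inversions (s l ∘ τ) + 0                                      ≡⟨ cong (λ b → inversions (s l ∘ τ) + indicator b) (≮⇒<ᵇ≡false (ℕₚ.<-asym asc)) ⟨
    inversions (s l ∘ τ) + indicator (toℕ (ρ (high l)) <ᵇ toℕ (ρ (low l))) ≡⟨ exchange ⟩
    inversions τ + indicator (toℕ (ρ (low l)) <ᵇ toℕ (ρ (high l))) ≡⟨ cong (λ b → inversions τ + indicator b) (<⇒<ᵇ≡true asc) ⟩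
    inversions τ + 1                                              ≡⟨ ℕₚ.+-comm _ 1 ⟩
    suc (inversions τ)                                            ∎
    where open ≡-Reasoning

  inversions-s∘-descent : toℕ (ρ (high l)) < toℕ (ρ (low l)) → suc (inversions (s l ∘ τ)) ≡ inversions τ
  inversions-s∘-descent desc = begin
    suc (inversions (s l ∘ τ))                                    ≡⟨ ℕₚ.+-comm 1 _ ⟩
    inversions (s l ∘ τ) + 1                                      ≡⟨ cong (λ b → inversions (s l ∘ τ) + indicator b) (<⇒<ᵇ≡true desc) ⟨
    inversions (s l ∘ τ) + indicator (toℕ (ρ (high l)) <ᵇ toℕ (ρ (low l))) ≡⟨ exchange ⟩
    inversions τ + indicator (toℕ (ρ (low l)) <ᵇ toℕ (ρ (high l))) ≡⟨ cong (λ b → inversions τ + indicator b) (≮⇒<ᵇ≡false (ℕₚ.<-asym desc)) ⟩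
    inversions τ + 0                                              ≡⟨ ℕₚ.+-identityʳ _ ⟩
    inversions τ                                                  ∎
    where open ≡-Reasoning

-- Bubble sort: repeatedly undo a descent of the inverse.
sortingWord : ∀ {n} (τ ρ : Perm n) → (∀ v → τ (ρ v) ≡ v) → (∀ i → ρ (τ i) ≡ i) →
              Σ (Word n) λ w → (∀ i → eval w i ≡ τ i) × length w ≡ inversions τ
sortingWord τ ρ τ∘ρ ρ∘τ = sort (inversions τ) τ ρ τ∘ρ ρ∘τ refl
  where
  sort : ∀ k {n} (τ ρ : Perm n) → (∀ v → τ (ρ v) ≡ v) → (∀ i → ρ (τ i) ≡ i) → inversions τ ≡ k →
         Σ (Word n) λ w → (∀ i → eval w i ≡ τ i) × length w ≡ k
  sort k {n} τ ρ τ∘ρ ρ∘τ τ≡k with Finₚ.any? {n = pred n} (λ j → toℕ (ρ (high {n} (letter j))) ℕₚ.<? toℕ (ρ (low (letter j))))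
  ... | yes (j , desc) with k
  ...   | zero   = ⊥-elim (ℕₚ.1+n≢0 (trans (inversions-s∘-descent τ ρ τ∘ρ ρ∘τ (letter j) desc) τ≡k))
  ...   | suc k′ =
    let l = letter j
        w , w≗ , |w| = sort k′ (s l ∘ τ) (ρ ∘ s l)
                         (λ v → trans (cong (s l) (τ∘ρ (s l v))) (s-involutive l v))
                         (λ i → trans (cong ρ (s-involutive l (τ i))) (ρ∘τ i))
                         (ℕₚ.suc-injective (trans (inversions-s∘-descent τ ρ τ∘ρ ρ∘τ l desc) τ≡k))
    in l ∷ w , (λ i → trans (cong (s l) (w≗ i)) (s-involutive l (τ i))) , cong suc |w|
  sort k {n} τ ρ τ∘ρ ρ∘τ τ≡k | no ¬desc = [] , τ≡id , trans (sym (ℕₚ.n≤0⇒n≡0 (inversions≤length {n} []))) (trans (inversions-cong τ≡id) τ≡k)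
    where
    ascending : ∀ x y → toℕ y ≡ suc (toℕ x) → toℕ (ρ x) < toℕ (ρ y)
    ascending x y y≡1+x with letterBetween x y y≡1+x
    ... | letter j , refl , refl = ℕₚ.≤∧≢⇒< (ℕₚ.≮⇒≥ (λ desc → ¬desc (j , desc)))
          (λ e → ℕₚ.1+n≢n (trans (sym y≡1+x) (cong toℕ (trans (sym (τ∘ρ _)) (trans (cong τ (sym (Finₚ.toℕ-injective e))) (τ∘ρ _))))))
    τ≡id : ∀ i → i ≡ τ i
    τ≡id i = trans (sym (τ∘ρ i)) (cong τ (ascending⇒identity ρ ascending i))

reduced⇒length≡inversions : ∀ {n} {τ : Perm n} w → IsReduced τ w → length w ≡ inversions τ
reduced⇒length≡inversions {τ = τ} w (w≗τ , minimal)
  with sortingWord τ (eval (reverse w)) (λ v → trans (sym (w≗τ _)) (eval∘eval-reverse w v))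
                                        (λ i → trans (cong (eval (reverse w)) (sym (w≗τ i))) (eval-reverse∘eval w i))
... | sorted , sorted≗τ , |sorted| = ℕₚ.≤-antisym
  (ℕₚ.≤-trans (minimal sorted sorted≗τ) (ℕₚ.≤-reflexive |sorted|))
  (ℕₚ.≤-trans (ℕₚ.≤-reflexive (inversions-cong (sym ∘ w≗τ))) (inversions≤length w))

reduced-no-ascent : ∀ {n} {τ : Perm n} p l v → IsReduced τ (p ++ l ∷ v) →
  ¬ (toℕ (eval (reverse (l ∷ v)) (low l)) < toℕ (eval (reverse (l ∷ v)) (high l)))
reduced-no-ascent {τ = τ} p l v (w≗τ , minimal) ascent
  with sortingWord (eval (l ∷ v)) (eval (reverse (l ∷ v))) (eval∘eval-reverse (l ∷ v)) (eval-reverse∘eval (l ∷ v))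
... | sorted , sorted≗ρ , |sorted| = ℕₚ.<⇒≱ longer shorter
  where
  ρ ρ⁻¹ : Perm _
  ρ   = eval (l ∷ v)
  ρ⁻¹ = eval (reverse (l ∷ v))

  p++sorted≗τ : ∀ i → eval (p ++ sorted) i ≡ τ i
  p++sorted≗τ i = begin
    eval (p ++ sorted) i   ≡⟨ eval-++ p sorted i ⟩
    eval p (eval sorted i) ≡⟨ cong (eval p) (sorted≗ρ i) ⟩
    eval p (ρ i)           ≡⟨ eval-++ p (l ∷ v) i ⟨
    eval (p ++ l ∷ v) i    ≡⟨ w≗τ i ⟩
    τ i                    ∎
    where open ≡-Reasoning

  shorter : length (p ++ l ∷ v) ≤ length p + inversions ρ
  shorter = begin
    length (p ++ l ∷ v)      ≤⟨ minimal (p ++ sorted) p++sorted≗τ ⟩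
    length (p ++ sorted)     ≡⟨ Listₚ.length-++ p ⟩
    length p + length sorted ≡⟨ cong (length p +_) |sorted| ⟩
    length p + inversions ρ  ∎
    where open ℕₚ.≤-Reasoning

  longer : length p + inversions ρ < length (p ++ l ∷ v)
  longer = begin-strict
    length p + inversions ρ            <⟨ ℕₚ.+-monoʳ-< (length p) (ℕₚ.n<1+n _) ⟩
    length p + suc (inversions ρ)      ≡⟨ cong (length p +_) (inversions-s∘-ascent ρ ρ⁻¹ (eval∘eval-reverse (l ∷ v)) (eval-reverse∘eval (l ∷ v)) l ascent) ⟨
    length p + inversions (s l ∘ ρ)    ≡⟨ cong (length p +_) (inversions-cong (s-involutive l ∘ eval v)) ⟩
    length p + inversions (eval v)     ≤⟨ ℕₚ.+-monoʳ-≤ (length p) (ℕₚ.m≤n⇒m≤1+n (inversions≤length v)) ⟩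
    length p + length (l ∷ v)          ≡⟨ Listₚ.length-++ p ⟨
    length (p ++ l ∷ v)                ∎
    where open ℕₚ.≤-Reasoning

length≡inversions⇒reduced : ∀ {n} {τ : Perm n} {w} → (∀ i → eval w i ≡ τ i) → length w ≡ inversions τ → IsReduced τ w
length≡inversions⇒reduced {τ = τ} {w} w≗τ |w|≡ℓ = w≗τ , λ w′ w′≗τ → begin
  length w             ≡⟨ |w|≡ℓ ⟩
  inversions τ         ≡⟨ inversions-cong (sym ∘ w′≗τ) ⟩
  inversions (eval w′) ≤⟨ inversions≤length w′ ⟩
  length w′            ∎
  where open ℕₚ.≤-Reasoning

-- Walks in the graph of reduced words

walk-map : ∀ {m n} (f : Word m → Word n) → (∀ {x y} → Move x y → Move (f x) (f y)) →
           ∀ {x y k} → Walk x y k → Walk (f x) (f y) k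
walk-map f move-f here             = here
walk-map f move-f (step (inj₁ m) p) = step (inj₁ (move-f m)) (walk-map f move-f p)
walk-map f move-f (step (inj₂ m) p) = step (inj₂ (move-f m)) (walk-map f move-f p)

module _ {n : ℕ} where

  adj-sym : {x y : Word n} → Adj x y → Adj y x
  adj-sym (inj₁ m) = inj₂ m
  adj-sym (inj₂ m) = inj₁ m

  walk-trans : ∀ {x y z : Word n} {k m} → Walk x y k → Walk y z m → Walk x z (k + m)
  walk-trans here       q = q
  walk-trans (step e p) q = step e (walk-trans p q)

  walk-sym : ∀ {x y : Word n} {k} → Walk x y k → Walk y x k
  walk-sym here = here
  walk-sym {k = suc k} (step e p) = subst (Walk _ _) (ℕₚ.+-comm k 1) (walk-trans (walk-sym p) (step (adj-sym e) here))

  move-++ˡ : ∀ (u : Word n) {x y} → Move x y → Move (u ++ x) (u ++ y)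
  move-++ˡ u (commute p v j k far) = subst₂ Move (Listₚ.++-assoc u p _) (Listₚ.++-assoc u p _) (commute (u ++ p) v j k far)
  move-++ˡ u (braid p v j k next)  = subst₂ Move (Listₚ.++-assoc u p _) (Listₚ.++-assoc u p _) (braid (u ++ p) v j k next)

  move-++ʳ : ∀ (t : Word n) {x y} → Move x y → Move (x ++ t) (y ++ t)
  move-++ʳ t (commute p v j k far) = subst₂ Move (sym (Listₚ.++-assoc p _ t)) (sym (Listₚ.++-assoc p _ t)) (commute p (v ++ t) j k far)
  move-++ʳ t (braid p v j k next)  = subst₂ Move (sym (Listₚ.++-assoc p _ t)) (sym (Listₚ.++-assoc p _ t)) (braid p (v ++ t) j k next)

  walk-∷ : ∀ (l : Letter n) {x y k} → Walk x y k → Walk (l ∷ x) (l ∷ y) k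
  walk-∷ l = walk-map (l ∷_) (move-++ˡ (l ∷ []))

  adj-++ˡ : ∀ (u : Word n) {x y} → Adj x y → Adj (u ++ x) (u ++ y)
  adj-++ˡ u (inj₁ m) = inj₁ (move-++ˡ u m)
  adj-++ˡ u (inj₂ m) = inj₂ (move-++ˡ u m)

  move-length : ∀ {x y : Word n} → Move x y → length x ≡ length y
  move-length (commute u _ _ _ _) = trans (Listₚ.length-++ u) (sym (Listₚ.length-++ u))
  move-length (braid u _ _ _ _)   = trans (Listₚ.length-++ u) (sym (Listₚ.length-++ u))

  adj-length : ∀ {x y : Word n} → Adj x y → length x ≡ length y
  adj-length (inj₁ m) = move-length m
  adj-length (inj₂ m) = sym (move-length m)

  module _ {P : Letter n → Set} where

    move-All : ∀ {x y} → Move x y → All P x → All P y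
    move-All (commute u _ _ _ _) Px with Allₚ.++⁻ u Px
    ... | Pu , Pj ∷ Pk ∷ Pv      = Allₚ.++⁺ Pu (Pk ∷ Pj ∷ Pv)
    move-All (braid u _ _ _ _)   Px with Allₚ.++⁻ u Px
    ... | Pu , Pj ∷ Pk ∷ _ ∷ Pv  = Allₚ.++⁺ Pu (Pk ∷ Pj ∷ Pk ∷ Pv)

    move-All⁻ : ∀ {x y} → Move x y → All P y → All P x
    move-All⁻ (commute u _ _ _ _) Py with Allₚ.++⁻ u Py
    ... | Pu , Pk ∷ Pj ∷ Pv      = Allₚ.++⁺ Pu (Pj ∷ Pk ∷ Pv)
    move-All⁻ (braid u _ _ _ _)   Py with Allₚ.++⁻ u Py
    ... | Pu , Pk ∷ Pj ∷ _ ∷ Pv  = Allₚ.++⁺ Pu (Pj ∷ Pk ∷ Pj ∷ Pv)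

    adj-All : ∀ {x y} → Adj x y → All P x → All P y
    adj-All (inj₁ m) = move-All m
    adj-All (inj₂ m) = move-All⁻ m

-- Counting inversions and 321-patterns

module _ {A : Set} {P : Pred A 0ℓ} (P? : Decidable P) where

  length-filter-∷ : ∀ x xs → length (filter P? (x ∷ xs)) ≡ indicator (does (P? x)) + length (filter P? xs)
  length-filter-∷ x xs with does (P? x)
  ... | true  = refl
  ... | false = refl

  length-filter-++ : ∀ xs ys → length (filter P? (xs ++ ys)) ≡ length (filter P? xs) + length (filter P? ys)
  length-filter-++ xs ys = trans (cong length (Listₚ.filter-++ P? xs ys)) (Listₚ.length-++ (filter P? xs))

  length-filter-tabulate : ∀ {n} (f : Fin n → A) → length (filter P? (tabulate f)) ≡ ∑[ i < n ] indicator (does (P? (f i)))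
  length-filter-tabulate {zero}  f = refl
  length-filter-tabulate {suc n} f = trans (length-filter-∷ (f Fin.zero) _) (cong (_ +_) (length-filter-tabulate (f ∘ Fin.suc)))

  length-filter-concatMap : ∀ {B : Set} {n} (f : Fin n → B) (g : B → List A) →
    length (filter P? (concatMap g (tabulate f))) ≡ ∑[ i < n ] length (filter P? (g (f i)))
  length-filter-concatMap {n = zero}  f g = refl
  length-filter-concatMap {n = suc n} f g =
    trans (length-filter-++ (g (f Fin.zero)) _) (cong (_ +_) (length-filter-concatMap (f ∘ Fin.suc) g))

  module _ {B : Set} {Q : Pred B 0ℓ} (Q? : Decidable Q) (h : B → A) (agree : ∀ x → does (P? (h x)) ≡ does (Q? x)) where

    filter-map : ∀ xs → filter P? (map h xs) ≡ map h (filter Q? xs)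
    filter-map []       = refl
    filter-map (x ∷ xs) with does (P? (h x)) | does (Q? x) | agree x
    ... | true  | true  | refl = cong (h x ∷_) (filter-map xs)
    ... | false | false | refl = filter-map xs

    length-filter-map : ∀ xs → length (filter P? (map h xs)) ≡ length (filter Q? xs)
    length-filter-map xs = trans (cong length (filter-map xs)) (Listₚ.length-map h (filter Q? xs))

  filter-map-none : ∀ {B : Set} (h : B → A) → (∀ x → does (P? (h x)) ≡ false) → ∀ xs → filter P? (map h xs) ≡ []
  filter-map-none h none []       = refl
  filter-map-none h none (x ∷ xs) with does (P? (h x)) | none x
  ... | false | refl = filter-map-none h none xs

  length-filter-map-all : ∀ {B : Set} (h : B → A) → (∀ x → does (P? (h x)) ≡ true) → ∀ xs → length (filter P? (map h xs)) ≡ length xs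
  length-filter-map-all h all []       = refl
  length-filter-map-all h all (x ∷ xs) with does (P? (h x)) | all x
  ... | true | refl = cong suc (length-filter-map-all h all xs)

  length-filter-pairs : ∀ {n} → (Q : Fin n → Fin n → A) → 
    length (filter P? (concatMap (λ i → map (Q i) (allFin n)) (allFin n))) ≡ ∑[ i < n ] ∑[ k < n ] indicator (does (P? (Q i k)))
  length-filter-pairs {n} Q = trans (length-filter-concatMap (λ i → i) (λ i → map (Q i) (allFin n)))
    (sum-cong-≗ λ i → trans (cong (length ∘ filter P?) (Listₚ.map-tabulate (λ k → k) (Q i))) (length-filter-tabulate (Q i)))

  filter-concatMap : ∀ {B : Set} (g : B → List A) xs → filter P? (concatMap g xs) ≡ concatMap (filter P? ∘ g) xs
  filter-concatMap g []       = refl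
  filter-concatMap g (x ∷ xs) = trans (Listₚ.filter-++ P? (g x) (concatMap g xs)) (cong (filter P? (g x) ++_) (filter-concatMap g xs))

module _ {A : Set} {P : Pred (A × A) 0ℓ} (P? : Decidable P) where

  private
    count : List (A × A) → ℕ
    count = length ∘ filter P?

  length-filter-unorderedPairs-++ : ∀ xs ys →
    count (unorderedPairs (xs ++ ys)) ≡ count (unorderedPairs xs) + count (unorderedPairs ys) + count (concatMap (λ x → map (x ,_) ys) xs)
  length-filter-unorderedPairs-++ []       ys = sym (ℕₚ.+-identityʳ _)
  length-filter-unorderedPairs-++ (x ∷ xs) ys = begin
    count (map (x ,_) (xs ++ ys) ++ unorderedPairs (xs ++ ys))
      ≡⟨ length-filter-++ P? (map (x ,_) (xs ++ ys)) _ ⟩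
    count (map (x ,_) (xs ++ ys)) + count (unorderedPairs (xs ++ ys))
      ≡⟨ cong₂ _+_ (trans (cong count (Listₚ.map-++ (x ,_) xs ys)) (length-filter-++ P? (map (x ,_) xs) _))
                   (length-filter-unorderedPairs-++ xs ys) ⟩
    (cx + cy) + (cxs + cys + cross)
      ≡⟨ solve 5 (λ cx cy cxs cys cross → (cx :+ cy) :+ (cxs :+ cys :+ cross) := cx :+ cxs :+ cys :+ (cy :+ cross)) refl cx cy cxs cys cross ⟩
    cx + cxs + cys + (cy + cross)
      ≡⟨ cong₂ (λ u v → u + cys + v) (length-filter-++ P? (map (x ,_) xs) _) (length-filter-++ P? (map (x ,_) ys) _) ⟨
    count (unorderedPairs (x ∷ xs)) + count (unorderedPairs ys) + count (concatMap (λ x → map (x ,_) ys) (x ∷ xs)) ∎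
    where
    open ≡-Reasoning
    cx = count (map (x ,_) xs)
    cy = count (map (x ,_) ys)
    cxs = count (unorderedPairs xs)
    cys = count (unorderedPairs ys)
    cross = count (concatMap (λ x → map (x ,_) ys) xs)

unorderedPairs-map : ∀ {A B : Set} (f : A → B) xs → unorderedPairs (map f xs) ≡ map (Prod.map f f) (unorderedPairs xs)
unorderedPairs-map f []       = refl
unorderedPairs-map f (x ∷ xs) =
  trans (cong₂ _++_ (trans (sym (Listₚ.map-∘ xs)) (Listₚ.map-∘ xs)) (unorderedPairs-map f xs))
        (sym (Listₚ.map-++ _ (map (x ,_) xs) (unorderedPairs xs)))

does-≟-injective : ∀ {m n} (f : Fin m → Fin n) → (∀ {x y} → f x ≡ f y → x ≡ y) → ∀ x y → does (f x Finₚ.≟ f y) ≡ does (x Finₚ.≟ y)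
does-≟-injective f f-inj x y with x Finₚ.≟ y
... | yes refl = dec-true (f x Finₚ.≟ f x) refl
... | no x≢y   = dec-false (f x Finₚ.≟ f y) (x≢y ∘ f-inj)

length-filter-triples : ∀ {n} {P : Pred (Fin n × Fin n × Fin n) 0ℓ} (P? : Decidable P) →
  length (filter P? (triples n)) ≡ ∑[ i < n ] ∑[ j < n ] ∑[ k < n ] indicator (does (P? (i , j , k)))
length-filter-triples {n} P? = trans (length-filter-concatMap P? (λ i → i) (λ i → map (i ,_) (pairs n)))
  (sum-cong-≗ λ i → trans (length-filter-map P? (P? ∘ (i ,_)) (i ,_) (λ _ → refl) (pairs n))
                          (length-filter-pairs (P? ∘ (i ,_)) _,_))

length-Inv : ∀ {n} (σ : Perm n) → length (Inv σ) ≡ inversions σ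
length-Inv {n} σ = length-filter-pairs {A = Fin n × Fin n} _ {n} _,_

is321 : ∀ {n} → Perm n → Fin n → Fin n → Fin n → Bool
is321 σ i j k = (toℕ i <ᵇ toℕ j) ∧ ((toℕ j <ᵇ toℕ k) ∧ ((toℕ (σ j) <ᵇ toℕ (σ i)) ∧ (toℕ (σ k) <ᵇ toℕ (σ j))))

module _ {n} (σ : Perm n) (i j k : Fin n) where

  is321-i<j : (toℕ i <ᵇ toℕ j) ≡ false → is321 σ i j k ≡ false
  is321-i<j e rewrite e = refl

  is321-j<k : (toℕ j <ᵇ toℕ k) ≡ false → is321 σ i j k ≡ false
  is321-j<k e rewrite e = ∧-zeroʳ (toℕ i <ᵇ toℕ j)

  is321-σj<σi : (toℕ (σ j) <ᵇ toℕ (σ i)) ≡ false → is321 σ i j k ≡ false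
  is321-σj<σi e rewrite e | ∧-zeroʳ (toℕ j <ᵇ toℕ k) = ∧-zeroʳ (toℕ i <ᵇ toℕ j)

  is321-σk<σj : (toℕ (σ k) <ᵇ toℕ (σ j)) ≡ false → is321 σ i j k ≡ false
  is321-σk<σj e rewrite e | ∧-zeroʳ (toℕ (σ j) <ᵇ toℕ (σ i)) | ∧-zeroʳ (toℕ j <ᵇ toℕ k) = ∧-zeroʳ (toℕ i <ᵇ toℕ j)

length-I3 : ∀ {n} (σ : Perm n) → length (I3 σ) ≡ ∑[ i < n ] ∑[ j < n ] ∑[ k < n ] indicator (is321 σ i j k)
length-I3 {n} σ = length-filter-triples {n} _

-- Direct sums

module DirectSum (a b : ℕ) where

  data Block (i : Fin (a + b)) : Set where
    inˡ : ∀ x → i ≡ x ↑ˡ b → Block i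
    inʳ : ∀ z → i ≡ a ↑ʳ z → Block i

  block : ∀ i → Block i
  block i with Fin.splitAt a i in eq
  ... | inj₁ x = inˡ x (sym (Finₚ.splitAt⁻¹-↑ˡ eq))
  ... | inj₂ z = inʳ z (sym (Finₚ.splitAt⁻¹-↑ʳ eq))

  toℕ-↑ʳ≥ : ∀ (z : Fin b) → a ≤ toℕ (a ↑ʳ z)
  toℕ-↑ʳ≥ z = ℕₚ.≤-trans (ℕₚ.m≤m+n a (toℕ z)) (ℕₚ.≤-reflexive (sym (Finₚ.toℕ-↑ʳ a z)))

  toℕ-↑ˡ< : ∀ (x : Fin a) → toℕ (x ↑ˡ b) < a
  toℕ-↑ˡ< x = subst (_< a) (sym (Finₚ.toℕ-↑ˡ x b)) (Finₚ.toℕ<n x)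

  ↑ˡ≢↑ʳ : ∀ (x : Fin a) (z : Fin b) → x ↑ˡ b ≢ a ↑ʳ z
  ↑ˡ≢↑ʳ x z e = ℕₚ.<⇒≱ (toℕ-↑ˡ< x) (subst (λ i → a ≤ toℕ i) (sym e) (toℕ-↑ʳ≥ z))

  module _ (α : Perm a) (β : Perm b) where

    dsum-↑ˡ : ∀ x → dsum α β (x ↑ˡ b) ≡ α x ↑ˡ b
    dsum-↑ˡ x rewrite Finₚ.splitAt-↑ˡ a x b = refl

    dsum-↑ʳ : ∀ z → dsum α β (a ↑ʳ z) ≡ a ↑ʳ β z
    dsum-↑ʳ z rewrite Finₚ.splitAt-↑ʳ a b z = refl

    dsum-preserves-< : ∀ i → toℕ i < a → toℕ (dsum α β i) < a
    dsum-preserves-< i i<a with block i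
    ... | inˡ x refl = subst (λ j → toℕ j < a) (sym (dsum-↑ˡ x)) (toℕ-↑ˡ< (α x))
    ... | inʳ z refl = ⊥-elim (ℕₚ.<⇒≱ i<a (toℕ-↑ʳ≥ z))

    dsum-preserves-≥ : ∀ i → a ≤ toℕ i → a ≤ toℕ (dsum α β i)
    dsum-preserves-≥ i a≤i with block i
    ... | inˡ x refl = ⊥-elim (ℕₚ.<⇒≱ (toℕ-↑ˡ< x) a≤i)
    ... | inʳ z refl = subst (λ j → a ≤ toℕ j) (sym (dsum-↑ʳ z)) (toℕ-↑ʳ≥ (β z))

  dsum-cong : ∀ {α α′ : Perm a} {β β′ : Perm b} → (∀ x → α x ≡ α′ x) → (∀ z → β z ≡ β′ z) →
              ∀ i → dsum α β i ≡ dsum α′ β′ i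
  dsum-cong {α} {α′} {β} {β′} α≗α′ β≗β′ i with block i
  ... | inˡ x refl = trans (dsum-↑ˡ α β x) (trans (cong (_↑ˡ b) (α≗α′ x)) (sym (dsum-↑ˡ α′ β′ x)))
  ... | inʳ z refl = trans (dsum-↑ʳ α β z) (trans (cong (a ↑ʳ_) (β≗β′ z)) (sym (dsum-↑ʳ α′ β′ z)))

  dsum-∘ : ∀ (α α′ : Perm a) (β β′ : Perm b) i → dsum α β (dsum α′ β′ i) ≡ dsum (α ∘ α′) (β ∘ β′) i
  dsum-∘ α α′ β β′ i with block i
  ... | inˡ x refl = trans (cong (dsum α β) (dsum-↑ˡ α′ β′ x)) (trans (dsum-↑ˡ α β (α′ x)) (sym (dsum-↑ˡ (α ∘ α′) (β ∘ β′) x)))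
  ... | inʳ z refl = trans (cong (dsum α β) (dsum-↑ʳ α′ β′ z)) (trans (dsum-↑ʳ α β (β′ z)) (sym (dsum-↑ʳ (α ∘ α′) (β ∘ β′) z)))

  dsum-id : ∀ i → dsum {a} {b} (λ x → x) (λ z → z) i ≡ i
  dsum-id i with block i
  ... | inˡ x refl = dsum-↑ˡ (λ x → x) (λ z → z) x
  ... | inʳ z refl = dsum-↑ʳ (λ x → x) (λ z → z) z

  dsum-injectiveˡ : ∀ {α α′ : Perm a} {β β′ : Perm b} → (∀ i → dsum α β i ≡ dsum α′ β′ i) → ∀ x → α x ≡ α′ x
  dsum-injectiveˡ {α} {α′} {β} {β′} eq x =
    Finₚ.↑ˡ-injective b _ _ (trans (sym (dsum-↑ˡ α β x)) (trans (eq (x ↑ˡ b)) (dsum-↑ˡ α′ β′ x)))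

  dsum-injectiveʳ : ∀ {α α′ : Perm a} {β β′ : Perm b} → (∀ i → dsum α β i ≡ dsum α′ β′ i) → ∀ z → β z ≡ β′ z
  dsum-injectiveʳ {α} {α′} {β} {β′} eq z =
    Finₚ.↑ʳ-injective a _ _ (trans (sym (dsum-↑ʳ α β z)) (trans (eq (a ↑ʳ z)) (dsum-↑ʳ α′ β′ z)))

  private
    <pred-+ : ∀ {t} c → t < pred c → a + t < pred (a + c)
    <pred-+ {t} (suc c) t<c = subst (a + t <_) (cong pred (sym (ℕₚ.+-suc a c))) (ℕₚ.+-monoʳ-< a t<c)

    ∸<pred : ∀ {t} c → a ≤ t → t < pred (a + c) → t ∸ a < pred c
    ∸<pred zero    a≤t t<a = ⊥-elim (ℕₚ.<⇒≱ (ℕₚ.<-≤-trans t<a (ℕₚ.≤-trans (ℕₚ.≤-reflexive (cong pred (ℕₚ.+-identityʳ a))) ℕₚ.pred[n]≤n)) a≤t)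
    ∸<pred {t} (suc c) a≤t t<a+c = ℕₚ.+-cancelˡ-< a _ _
      (subst (_< a + c) (sym (ℕₚ.m+[n∸m]≡n a≤t)) (subst (t <_) (cong pred (ℕₚ.+-suc a c)) t<a+c))

  liftˡ : Letter a → Letter (a + b)
  liftˡ (letter j) = letter (fromℕ< (ℕₚ.<-≤-trans (Finₚ.toℕ<n j) (ℕₚ.pred-mono-≤ (ℕₚ.m≤m+n a b))))

  liftʳ : Letter b → Letter (a + b)
  liftʳ (letter k) = letter (fromℕ< (<pred-+ b (Finₚ.toℕ<n k)))

  toℕ-liftˡ : ∀ j → toℕ (idx (liftˡ j)) ≡ toℕ (idx j)
  toℕ-liftˡ (letter j) = Finₚ.toℕ-fromℕ< _

  toℕ-liftʳ : ∀ k → toℕ (idx (liftʳ k)) ≡ a + toℕ (idx k)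
  toℕ-liftʳ (letter k) = Finₚ.toℕ-fromℕ< _

  liftˡ-below : ∀ j → suc (toℕ (idx (liftˡ j))) < a
  liftˡ-below j = subst (λ t → suc t < a) (sym (toℕ-liftˡ j)) (below (idx j))
    where
    below : ∀ {c} (t : Fin (pred c)) → suc (toℕ t) < c
    below {suc _} t = s≤s (Finₚ.toℕ<n t)

  liftʳ-above : ∀ k → a ≤ toℕ (idx (liftʳ k))
  liftʳ-above k = subst (a ≤_) (sym (toℕ-liftʳ k)) (ℕₚ.m≤m+n a _)

  liftˡ-far-liftʳ : ∀ j k → suc (toℕ (idx (liftˡ j))) < toℕ (idx (liftʳ k))
  liftˡ-far-liftʳ j k = ℕₚ.<-≤-trans (liftˡ-below j) (liftʳ-above k)

  private
    s-liftˡ-↑ˡ : ∀ j x → s (liftˡ j) (x ↑ˡ b) ≡ s j x ↑ˡ b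
    s-liftˡ-↑ˡ j x = Finₚ.toℕ-injective (begin
      toℕ (s (liftˡ j) (x ↑ˡ b))                ≡⟨ toℕ-s (liftˡ j) _ ⟩
      swapℕ (toℕ (idx (liftˡ j))) (toℕ (x ↑ˡ b)) ≡⟨ cong₂ swapℕ (toℕ-liftˡ j) (Finₚ.toℕ-↑ˡ x b) ⟩
      swapℕ (toℕ (idx j)) (toℕ x)                ≡⟨ toℕ-s j x ⟨
      toℕ (s j x)                                ≡⟨ Finₚ.toℕ-↑ˡ (s j x) b ⟨
      toℕ (s j x ↑ˡ b)                           ∎)
      where open ≡-Reasoning

    s-liftˡ-↑ʳ : ∀ j z → s (liftˡ j) (a ↑ʳ z) ≡ a ↑ʳ z
    s-liftˡ-↑ʳ j z = Finₚ.toℕ-injective (trans (toℕ-s (liftˡ j) _)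
      (swapℕ-other (λ e → ℕₚ.<⇒≱ (liftˡ-below j) (ℕₚ.≤-trans (toℕ-↑ʳ≥ z) (ℕₚ.≤-trans (ℕₚ.≤-reflexive e) (ℕₚ.n≤1+n _))))
                   (λ e → ℕₚ.<⇒≱ (liftˡ-below j) (ℕₚ.≤-trans (toℕ-↑ʳ≥ z) (ℕₚ.≤-reflexive e)))))

    s-liftʳ-↑ˡ : ∀ k x → s (liftʳ k) (x ↑ˡ b) ≡ x ↑ˡ b
    s-liftʳ-↑ˡ k x = Finₚ.toℕ-injective (trans (toℕ-s (liftʳ k) _)
      (swapℕ-other (λ e → ℕₚ.<⇒≱ (toℕ-↑ˡ< x) (ℕₚ.≤-trans (liftʳ-above k) (ℕₚ.≤-reflexive (sym e))))
                   (λ e → ℕₚ.<⇒≱ (toℕ-↑ˡ< x) (ℕₚ.≤-trans (liftʳ-above k) (ℕₚ.≤-trans (ℕₚ.n≤1+n _) (ℕₚ.≤-reflexive (sym e)))))))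

    s-liftʳ-↑ʳ : ∀ k z → s (liftʳ k) (a ↑ʳ z) ≡ a ↑ʳ s k z
    s-liftʳ-↑ʳ k z = Finₚ.toℕ-injective (begin
      toℕ (s (liftʳ k) (a ↑ʳ z))                   ≡⟨ toℕ-s (liftʳ k) _ ⟩
      swapℕ (toℕ (idx (liftʳ k))) (toℕ (a ↑ʳ z))   ≡⟨ cong₂ swapℕ (toℕ-liftʳ k) (Finₚ.toℕ-↑ʳ a z) ⟩
      swapℕ (a + toℕ (idx k)) (a + toℕ z)          ≡⟨ swapℕ-+ a _ _ ⟩
      a + swapℕ (toℕ (idx k)) (toℕ z)              ≡⟨ cong (a +_) (toℕ-s k z) ⟨
      a + toℕ (s k z)                              ≡⟨ Finₚ.toℕ-↑ʳ a (s k z) ⟨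
      toℕ (a ↑ʳ s k z)                             ∎)
      where open ≡-Reasoning

  s-liftˡ : ∀ j (α : Perm a) (β : Perm b) i → s (liftˡ j) (dsum α β i) ≡ dsum (s j ∘ α) β i
  s-liftˡ j α β i with block i
  ... | inˡ x refl = trans (cong (s (liftˡ j)) (dsum-↑ˡ α β x)) (trans (s-liftˡ-↑ˡ j (α x)) (sym (dsum-↑ˡ (s j ∘ α) β x)))
  ... | inʳ z refl = trans (cong (s (liftˡ j)) (dsum-↑ʳ α β z)) (trans (s-liftˡ-↑ʳ j (β z)) (sym (dsum-↑ʳ (s j ∘ α) β z)))

  s-liftʳ : ∀ k (α : Perm a) (β : Perm b) i → s (liftʳ k) (dsum α β i) ≡ dsum α (s k ∘ β) i
  s-liftʳ k α β i with block i
  ... | inˡ x refl = trans (cong (s (liftʳ k)) (dsum-↑ˡ α β x)) (trans (s-liftʳ-↑ˡ k (α x)) (sym (dsum-↑ˡ α (s k ∘ β) x)))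
  ... | inʳ z refl = trans (cong (s (liftʳ k)) (dsum-↑ʳ α β z)) (trans (s-liftʳ-↑ʳ k (β z)) (sym (dsum-↑ʳ α (s k ∘ β) z)))

  -- middle is the paper's letter a, the only one acting on both blocks.
  data Side : Set where
    left   : Letter a → Side
    middle : Side
    right  : Letter b → Side

  side : Letter (a + b) → Side
  side l with ℕₚ.<-cmp (suc (toℕ (idx l))) a
  ... | tri< l<a _ _ = left (letter (fromℕ< (ℕₚ.pred-mono-≤ l<a)))
  ... | tri≈ _ _ _   = middle
  ... | tri> _ _ a<l = right (letter (fromℕ< (∸<pred b (ℕₚ.≤-pred a<l) (Finₚ.toℕ<n (idx l)))))

  data SideView (l : Letter (a + b)) : Side → Set where
    left   : ∀ j → l ≡ liftˡ j → SideView l (left j)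
    middle : suc (toℕ (idx l)) ≡ a → SideView l middle
    right  : ∀ k → l ≡ liftʳ k → SideView l (right k)

  sideView : ∀ l → SideView l (side l)
  sideView l with ℕₚ.<-cmp (suc (toℕ (idx l))) a
  ... | tri< _ _ _   = left _ (letter-≡ (sym (trans (toℕ-liftˡ _) (Finₚ.toℕ-fromℕ< _))))
  ... | tri≈ _ e _   = middle e
  ... | tri> _ _ a<l = right _ (letter-≡ (sym (trans (toℕ-liftʳ _)
                         (trans (cong (a +_) (Finₚ.toℕ-fromℕ< _)) (ℕₚ.m+[n∸m]≡n (ℕₚ.≤-pred a<l))))))

  side-liftˡ : ∀ j → side (liftˡ j) ≡ left j
  side-liftˡ j with side (liftˡ j) | sideView (liftˡ j)
  ... | left j′ | left .j′ e = cong left (letter-≡ (trans (sym (toℕ-liftˡ j′)) (trans (cong (toℕ ∘ idx) (sym e)) (toℕ-liftˡ j))))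
  ... | middle  | middle e   = ⊥-elim (ℕₚ.<-irrefl e (liftˡ-below j))
  ... | right k | right .k e = ⊥-elim (ℕₚ.<⇒≱ (ℕₚ.<-trans (ℕₚ.n<1+n _) (liftˡ-below j)) (subst (λ l → a ≤ toℕ (idx l)) (sym e) (liftʳ-above k)))

  side-liftʳ : ∀ k → side (liftʳ k) ≡ right k
  side-liftʳ k with side (liftʳ k) | sideView (liftʳ k)
  ... | left j  | left .j e  = ⊥-elim (ℕₚ.<⇒≱ (ℕₚ.<-trans (ℕₚ.n<1+n _) (liftˡ-below j)) (subst (λ l → a ≤ toℕ (idx l)) e (liftʳ-above k)))
  ... | middle  | middle e   = ⊥-elim (ℕₚ.<⇒≢ (s≤s (liftʳ-above k)) (sym e))
  ... | right k′ | right .k′ e = cong right (letter-≡ (ℕₚ.+-cancelˡ-≡ a _ _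
                                   (trans (sym (toℕ-liftʳ k′)) (trans (cong (toℕ ∘ idx) (sym e)) (toℕ-liftʳ k)))))

  private
    keepˡ : Side → Word a → Word a
    keepˡ (left j) u = j ∷ u
    keepˡ _        u = u

    keepʳ : Side → Word b → Word b
    keepʳ (right k) v = k ∷ v
    keepʳ _         v = v

  projˡ : Word (a + b) → Word a
  projˡ []      = []
  projˡ (l ∷ w) = keepˡ (side l) (projˡ w)

  projʳ : Word (a + b) → Word b
  projʳ []      = []
  projʳ (l ∷ w) = keepʳ (side l) (projʳ w)

  AvoidsMiddle : Word (a + b) → Set
  AvoidsMiddle = All (λ l → side l ≢ middle)

  leftFirst : Word a → Word b → Word (a + b)
  leftFirst u v = map liftˡ u ++ map liftʳ v

  rightFirst : Word a → Word b → Word (a + b)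
  rightFirst u v = map liftʳ v ++ map liftˡ u

  projˡ-∷liftˡ : ∀ j w → projˡ (liftˡ j ∷ w) ≡ j ∷ projˡ w
  projˡ-∷liftˡ j w rewrite side-liftˡ j = refl

  projʳ-∷liftˡ : ∀ j w → projʳ (liftˡ j ∷ w) ≡ projʳ w
  projʳ-∷liftˡ j w rewrite side-liftˡ j = refl

  projˡ-∷liftʳ : ∀ k w → projˡ (liftʳ k ∷ w) ≡ projˡ w
  projˡ-∷liftʳ k w rewrite side-liftʳ k = refl

  projʳ-∷liftʳ : ∀ k w → projʳ (liftʳ k ∷ w) ≡ k ∷ projʳ w
  projʳ-∷liftʳ k w rewrite side-liftʳ k = refl

  projˡ-++ : ∀ u v → projˡ (u ++ v) ≡ projˡ u ++ projˡ v
  projˡ-++ []      v = refl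
  projˡ-++ (l ∷ u) v with side l
  ... | left j  = cong (j ∷_) (projˡ-++ u v)
  ... | middle  = projˡ-++ u v
  ... | right _ = projˡ-++ u v

  projʳ-++ : ∀ u v → projʳ (u ++ v) ≡ projʳ u ++ projʳ v
  projʳ-++ []      v = refl
  projʳ-++ (l ∷ u) v with side l
  ... | left _  = projʳ-++ u v
  ... | middle  = projʳ-++ u v
  ... | right k = cong (k ∷_) (projʳ-++ u v)

  projˡ-map-liftˡ : ∀ u → projˡ (map liftˡ u) ≡ u
  projˡ-map-liftˡ []      = refl
  projˡ-map-liftˡ (j ∷ u) = trans (projˡ-∷liftˡ j (map liftˡ u)) (cong (j ∷_) (projˡ-map-liftˡ u))

  projʳ-map-liftˡ : ∀ u → projʳ (map liftˡ u) ≡ []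
  projʳ-map-liftˡ []      = refl
  projʳ-map-liftˡ (j ∷ u) = trans (projʳ-∷liftˡ j (map liftˡ u)) (projʳ-map-liftˡ u)

  projˡ-map-liftʳ : ∀ v → projˡ (map liftʳ v) ≡ []
  projˡ-map-liftʳ []      = refl
  projˡ-map-liftʳ (k ∷ v) = trans (projˡ-∷liftʳ k (map liftʳ v)) (projˡ-map-liftʳ v)

  projʳ-map-liftʳ : ∀ v → projʳ (map liftʳ v) ≡ v
  projʳ-map-liftʳ []      = refl
  projʳ-map-liftʳ (k ∷ v) = trans (projʳ-∷liftʳ k (map liftʳ v)) (cong (k ∷_) (projʳ-map-liftʳ v))

  projˡ-leftFirst : ∀ u v → projˡ (leftFirst u v) ≡ u
  projˡ-leftFirst u v = trans (projˡ-++ (map liftˡ u) _)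
    (trans (cong₂ _++_ (projˡ-map-liftˡ u) (projˡ-map-liftʳ v)) (Listₚ.++-identityʳ u))

  projʳ-leftFirst : ∀ u v → projʳ (leftFirst u v) ≡ v
  projʳ-leftFirst u v = trans (projʳ-++ (map liftˡ u) _) (cong₂ _++_ (projʳ-map-liftˡ u) (projʳ-map-liftʳ v))

  projˡ-rightFirst : ∀ u v → projˡ (rightFirst u v) ≡ u
  projˡ-rightFirst u v = trans (projˡ-++ (map liftʳ v) _) (cong₂ _++_ (projˡ-map-liftʳ v) (projˡ-map-liftˡ u))

  projʳ-rightFirst : ∀ u v → projʳ (rightFirst u v) ≡ v
  projʳ-rightFirst u v = trans (projʳ-++ (map liftʳ v) _)
    (trans (cong₂ _++_ (projʳ-map-liftʳ v) (projʳ-map-liftˡ u)) (Listₚ.++-identityʳ v))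

  avoidsMiddle-map-liftˡ : ∀ u → AvoidsMiddle (map liftˡ u)
  avoidsMiddle-map-liftˡ []      = []
  avoidsMiddle-map-liftˡ (j ∷ u) = (λ e → left≢middle (trans (sym (side-liftˡ j)) e)) ∷ avoidsMiddle-map-liftˡ u
    where
    left≢middle : left j ≢ middle
    left≢middle ()

  avoidsMiddle-map-liftʳ : ∀ v → AvoidsMiddle (map liftʳ v)
  avoidsMiddle-map-liftʳ []      = []
  avoidsMiddle-map-liftʳ (k ∷ v) = (λ e → right≢middle (trans (sym (side-liftʳ k)) e)) ∷ avoidsMiddle-map-liftʳ v
    where
    right≢middle : right k ≢ middle
    right≢middle ()

  avoidsMiddle-leftFirst : ∀ u v → AvoidsMiddle (leftFirst u v)
  avoidsMiddle-leftFirst u v = Allₚ.++⁺ (avoidsMiddle-map-liftˡ u) (avoidsMiddle-map-liftʳ v)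

  avoidsMiddle-rightFirst : ∀ u v → AvoidsMiddle (rightFirst u v)
  avoidsMiddle-rightFirst u v = Allₚ.++⁺ (avoidsMiddle-map-liftʳ v) (avoidsMiddle-map-liftˡ u)

  eval-avoidsMiddle : ∀ w → AvoidsMiddle w → ∀ i → eval w i ≡ dsum (eval (projˡ w)) (eval (projʳ w)) i
  eval-avoidsMiddle []      _             i = sym (dsum-id i)
  eval-avoidsMiddle (l ∷ w) (l≢middle ∷ w-avoids) i with side l | sideView l
  ... | left j  | left .j refl  = trans (cong (s (liftˡ j)) (eval-avoidsMiddle w w-avoids i)) (s-liftˡ j _ _ i)
  ... | middle  | _             = ⊥-elim (l≢middle refl)
  ... | right k | right .k refl = trans (cong (s (liftʳ k)) (eval-avoidsMiddle w w-avoids i)) (s-liftʳ k _ _ i)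

  length-avoidsMiddle : ∀ w → AvoidsMiddle w → length w ≡ length (projˡ w) + length (projʳ w)
  length-avoidsMiddle []      _ = refl
  length-avoidsMiddle (l ∷ w) (l≢middle ∷ w-avoids) with side l
  ... | left _  = cong suc (length-avoidsMiddle w w-avoids)
  ... | middle  = ⊥-elim (l≢middle refl)
  ... | right _ = trans (cong suc (length-avoidsMiddle w w-avoids)) (sym (ℕₚ.+-suc _ _))

  length-leftFirst : ∀ u v → length (leftFirst u v) ≡ length u + length v
  length-leftFirst u v = trans (Listₚ.length-++ (map liftˡ u)) (cong₂ _+_ (Listₚ.length-map liftˡ u) (Listₚ.length-map liftʳ v))

  length-rightFirst : ∀ u v → length (rightFirst u v) ≡ length u + length v
  length-rightFirst u v = trans (Listₚ.length-++ (map liftʳ v))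
    (trans (cong₂ _+_ (Listₚ.length-map liftʳ v) (Listₚ.length-map liftˡ u)) (ℕₚ.+-comm (length v) (length u)))

  eval-leftFirst : ∀ u v i → eval (leftFirst u v) i ≡ dsum (eval u) (eval v) i
  eval-leftFirst u v i = trans (eval-avoidsMiddle _ (avoidsMiddle-leftFirst u v) i)
    (cong₂ (λ u′ v′ → dsum (eval u′) (eval v′) i) (projˡ-leftFirst u v) (projʳ-leftFirst u v))

  eval-rightFirst : ∀ u v i → eval (rightFirst u v) i ≡ dsum (eval u) (eval v) i
  eval-rightFirst u v i = trans (eval-avoidsMiddle _ (avoidsMiddle-rightFirst u v) i)
    (cong₂ (λ u′ v′ → dsum (eval u′) (eval v′) i) (projˡ-rightFirst u v) (projʳ-rightFirst u v))

  middle? : (σ : Side) → Dec (σ ≡ middle)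
  middle? (left _)  = no λ ()
  middle? middle    = yes refl
  middle? (right _) = no λ ()

  firstMiddle : ∀ w → AvoidsMiddle w ⊎
                Σ (Word (a + b)) λ p → Σ (Letter (a + b)) λ c → Σ (Word (a + b)) λ v →
                  w ≡ p ++ c ∷ v × AvoidsMiddle p × side c ≡ middle
  firstMiddle []      = inj₁ []
  firstMiddle (l ∷ w) with middle? (side l) | firstMiddle w
  ... | yes l-mid | _                                = inj₂ ([] , l , w , refl , [] , l-mid)
  ... | no l≢mid  | inj₁ w-avoids                    = inj₁ (l≢mid ∷ w-avoids)
  ... | no l≢mid  | inj₂ (p , c , v , refl , p-avoids , c-mid) = inj₂ (l ∷ p , c , v , refl , l≢mid ∷ p-avoids , c-mid)

  -- Reduced words of a direct sum

  ↑ʳ<ᵇ↑ˡ : ∀ (z : Fin b) (x : Fin a) → (toℕ (a ↑ʳ z) <ᵇ toℕ (x ↑ˡ b)) ≡ false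
  ↑ʳ<ᵇ↑ˡ z x = ≮⇒<ᵇ≡false (λ z<x → ℕₚ.<⇒≱ (ℕₚ.<-trans z<x (toℕ-↑ˡ< x)) (toℕ-↑ʳ≥ z))

  ↑ˡ<ᵇ↑ˡ : ∀ (x y : Fin a) → (toℕ (x ↑ˡ b) <ᵇ toℕ (y ↑ˡ b)) ≡ (toℕ x <ᵇ toℕ y)
  ↑ˡ<ᵇ↑ˡ x y = cong₂ _<ᵇ_ (Finₚ.toℕ-↑ˡ x b) (Finₚ.toℕ-↑ˡ y b)

  ↑ʳ<ᵇ↑ʳ : ∀ (z z′ : Fin b) → (toℕ (a ↑ʳ z) <ᵇ toℕ (a ↑ʳ z′)) ≡ (toℕ z <ᵇ toℕ z′)
  ↑ʳ<ᵇ↑ʳ z z′ = trans (cong₂ _<ᵇ_ (Finₚ.toℕ-↑ʳ a z) (Finₚ.toℕ-↑ʳ a z′)) (+-<ᵇ-cancelˡ a _ _)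

  module _ (α : Perm a) (β : Perm b) where

    private
      π = dsum α β

    π<ᵇ-↑ˡ↑ˡ : ∀ x y → (toℕ (π (x ↑ˡ b)) <ᵇ toℕ (π (y ↑ˡ b))) ≡ (toℕ (α x) <ᵇ toℕ (α y))
    π<ᵇ-↑ˡ↑ˡ x y = trans (cong₂ (λ u v → toℕ u <ᵇ toℕ v) (dsum-↑ˡ α β x) (dsum-↑ˡ α β y)) (↑ˡ<ᵇ↑ˡ (α x) (α y))

    π<ᵇ-↑ʳ↑ˡ : ∀ z x → (toℕ (π (a ↑ʳ z)) <ᵇ toℕ (π (x ↑ˡ b))) ≡ false
    π<ᵇ-↑ʳ↑ˡ z x = trans (cong₂ (λ u v → toℕ u <ᵇ toℕ v) (dsum-↑ʳ α β z) (dsum-↑ˡ α β x)) (↑ʳ<ᵇ↑ˡ (β z) (α x))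

    π<ᵇ-↑ʳ↑ʳ : ∀ z z′ → (toℕ (π (a ↑ʳ z)) <ᵇ toℕ (π (a ↑ʳ z′))) ≡ (toℕ (β z) <ᵇ toℕ (β z′))
    π<ᵇ-↑ʳ↑ʳ z z′ = trans (cong₂ (λ u v → toℕ u <ᵇ toℕ v) (dsum-↑ʳ α β z) (dsum-↑ʳ α β z′)) (↑ʳ<ᵇ↑ʳ (β z) (β z′))

    isInversion-↑ˡ↑ˡ : ∀ x y → isInversion π (x ↑ˡ b) (y ↑ˡ b) ≡ isInversion α x y
    isInversion-↑ˡ↑ˡ x y = cong₂ _∧_ (↑ˡ<ᵇ↑ˡ x y) (π<ᵇ-↑ˡ↑ˡ y x)

    isInversion-↑ˡ↑ʳ : ∀ x z → isInversion π (x ↑ˡ b) (a ↑ʳ z) ≡ false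
    isInversion-↑ˡ↑ʳ x z = trans (cong ((toℕ (x ↑ˡ b) <ᵇ toℕ (a ↑ʳ z)) ∧_) (π<ᵇ-↑ʳ↑ˡ z x)) (∧-zeroʳ _)

    isInversion-↑ʳ↑ˡ : ∀ z x → isInversion π (a ↑ʳ z) (x ↑ˡ b) ≡ false
    isInversion-↑ʳ↑ˡ z x = cong (_∧ (toℕ (π (x ↑ˡ b)) <ᵇ toℕ (π (a ↑ʳ z)))) (↑ʳ<ᵇ↑ˡ z x)

    isInversion-↑ʳ↑ʳ : ∀ z z′ → isInversion π (a ↑ʳ z) (a ↑ʳ z′) ≡ isInversion β z z′
    isInversion-↑ʳ↑ʳ z z′ = cong₂ _∧_ (↑ʳ<ᵇ↑ʳ z z′) (π<ᵇ-↑ʳ↑ʳ z′ z)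

    inversions-dsum : inversions π ≡ inversions α + inversions β
    inversions-dsum = trans (sum-↑ a b _) (cong₂ _+_ (sum-cong-≗ rowˡ) (sum-cong-≗ rowʳ))
      where
      rowˡ : ∀ x → sum (inversionAt π (x ↑ˡ b)) ≡ sum (inversionAt α x)
      rowˡ x = trans (sum-↑ˡ a b _ (cong indicator ∘ isInversion-↑ˡ↑ʳ x)) (sum-cong-≗ (cong indicator ∘ isInversion-↑ˡ↑ˡ x))
      rowʳ : ∀ z → sum (inversionAt π (a ↑ʳ z)) ≡ sum (inversionAt β z)
      rowʳ z = trans (sum-↑ʳ a b _ (cong indicator ∘ isInversion-↑ʳ↑ˡ z)) (sum-cong-≗ (cong indicator ∘ isInversion-↑ʳ↑ʳ z))

    -- The prefix before the first middle letter c acts block-diagonally, hence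
    -- so does the suffix starting at c, on which c is then an ascent.
    reduced⇒avoidsMiddle : ∀ w → IsReduced π w → AvoidsMiddle w
    reduced⇒avoidsMiddle w (w≗π , minimal) with firstMiddle w
    ... | inj₁ w-avoids = w-avoids
    ... | inj₂ (p , c , v , refl , p-avoids , c-middle) = ⊥-elim (reduced-no-ascent p c v (w≗π , minimal) ascent)
      where
      ρ ρ⁻¹ : Perm (a + b)
      ρ   = eval (c ∷ v)
      ρ⁻¹ = eval (reverse (c ∷ v))

      ρ-blocks : ∀ i → ρ i ≡ dsum (eval (projˡ (reverse p)) ∘ α) (eval (projʳ (reverse p)) ∘ β) i
      ρ-blocks i = begin
        ρ i                                   ≡⟨ eval-reverse∘eval p (ρ i) ⟨
        eval (reverse p) (eval p (ρ i))       ≡⟨ cong (eval (reverse p)) (trans (sym (eval-++ p (c ∷ v) i)) (w≗π i)) ⟩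
        eval (reverse p) (π i)                ≡⟨ eval-avoidsMiddle (reverse p) (All-reverse p-avoids) (π i) ⟩
        dsum (eval (projˡ (reverse p))) (eval (projʳ (reverse p))) (π i) ≡⟨ dsum-∘ _ α _ β i ⟩
        dsum (eval (projˡ (reverse p)) ∘ α) (eval (projʳ (reverse p)) ∘ β) i ∎
        where open ≡-Reasoning

      c-joins : suc (toℕ (idx c)) ≡ a
      c-joins with side c | sideView c
      ... | middle | middle e = e

      low<a : toℕ (low c) < a
      low<a = subst (_< a) (sym (toℕ-low c)) (ℕₚ.≤-reflexive c-joins)

      a≤high : a ≤ toℕ (high c)
      a≤high = ℕₚ.≤-reflexive (trans (sym c-joins) (sym (toℕ-high c)))

      ρρ⁻¹ : ∀ i → dsum (eval (projˡ (reverse p)) ∘ α) (eval (projʳ (reverse p)) ∘ β) (ρ⁻¹ i) ≡ i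
      ρρ⁻¹ i = trans (sym (ρ-blocks (ρ⁻¹ i))) (eval∘eval-reverse (c ∷ v) i)

      lowPos<a : toℕ (ρ⁻¹ (low c)) < a
      lowPos<a = ℕₚ.≰⇒> λ a≤ → ℕₚ.<⇒≱ low<a (subst (λ i → a ≤ toℕ i) (ρρ⁻¹ (low c)) (dsum-preserves-≥ _ _ _ a≤))

      a≤highPos : a ≤ toℕ (ρ⁻¹ (high c))
      a≤highPos = ℕₚ.≮⇒≥ λ <a → ℕₚ.<⇒≱ (subst (λ i → toℕ i < a) (ρρ⁻¹ (high c)) (dsum-preserves-< _ _ _ <a)) a≤high

      ascent : toℕ (ρ⁻¹ (low c)) < toℕ (ρ⁻¹ (high c))
      ascent = ℕₚ.<-≤-trans lowPos<a a≤highPos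

    private
      projections-eval : ∀ w → IsReduced π w → ∀ i → dsum (eval (projˡ w)) (eval (projʳ w)) i ≡ π i
      projections-eval w r@(w≗π , _) i = trans (sym (eval-avoidsMiddle w (reduced⇒avoidsMiddle w r) i)) (w≗π i)

    reduced-projˡ : ∀ w → IsReduced π w → IsReduced α (projˡ w)
    reduced-projˡ w r@(_ , minimal) = dsum-injectiveˡ (projections-eval w r) , λ u u≗α →
      ℕₚ.+-cancelʳ-≤ (length (projʳ w)) _ _ (begin
        length (projˡ w) + length (projʳ w) ≡⟨ length-avoidsMiddle w (reduced⇒avoidsMiddle w r) ⟨
        length w                            ≤⟨ minimal (leftFirst u (projʳ w)) (λ i → trans (eval-leftFirst u (projʳ w) i)
                                                 (dsum-cong u≗α (dsum-injectiveʳ (projections-eval w r)) i)) ⟩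
        length (leftFirst u (projʳ w))      ≡⟨ length-leftFirst u (projʳ w) ⟩
        length u + length (projʳ w)         ∎)
      where open ℕₚ.≤-Reasoning

    reduced-projʳ : ∀ w → IsReduced π w → IsReduced β (projʳ w)
    reduced-projʳ w r@(_ , minimal) = dsum-injectiveʳ (projections-eval w r) , λ v v≗β →
      ℕₚ.+-cancelˡ-≤ (length (projˡ w)) _ _ (begin
        length (projˡ w) + length (projʳ w) ≡⟨ length-avoidsMiddle w (reduced⇒avoidsMiddle w r) ⟨
        length w                            ≤⟨ minimal (leftFirst (projˡ w) v) (λ i → trans (eval-leftFirst (projˡ w) v i)
                                                 (dsum-cong (dsum-injectiveˡ (projections-eval w r)) v≗β i)) ⟩
        length (leftFirst (projˡ w) v)      ≡⟨ length-leftFirst (projˡ w) v ⟩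
        length (projˡ w) + length v         ∎)
      where open ℕₚ.≤-Reasoning

    private
      length≡inversions-π : ∀ u v → IsReduced α u → IsReduced β v → length u + length v ≡ inversions π
      length≡inversions-π u v ru rv = trans (cong₂ _+_ (reduced⇒length≡inversions u ru) (reduced⇒length≡inversions v rv))
                                        (sym inversions-dsum)

    reduced-leftFirst : ∀ u v → IsReduced α u → IsReduced β v → IsReduced π (leftFirst u v)
    reduced-leftFirst u v ru rv = length≡inversions⇒reduced {w = leftFirst u v}
      (λ i → trans (eval-leftFirst u v i) (dsum-cong (proj₁ ru) (proj₁ rv) i))
      (trans (length-leftFirst u v) (length≡inversions-π u v ru rv))

    reduced-rightFirst : ∀ u v → IsReduced α u → IsReduced β v → IsReduced π (rightFirst u v)
    reduced-rightFirst u v ru rv = length≡inversions⇒reduced {w = rightFirst u v}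
      (λ i → trans (eval-rightFirst u v i) (dsum-cong (proj₁ ru) (proj₁ rv) i))
      (trans (length-rightFirst u v) (length≡inversions-π u v ru rv))

  -- Walks between reduced words of a direct sum

  move-map-liftˡ : ∀ {u v} → Move u v → Move (map liftˡ u) (map liftˡ v)
  move-map-liftˡ (commute p q j k far) =
    subst₂ Move (sym (Listₚ.map-++ liftˡ p _)) (sym (Listₚ.map-++ liftˡ p _))
      (commute (map liftˡ p) (map liftˡ q) (liftˡ j) (liftˡ k)
        (subst₂ (λ x y → suc x < y ⊎ suc y < x) (sym (toℕ-liftˡ j)) (sym (toℕ-liftˡ k)) far))
  move-map-liftˡ (braid p q j k next) =
    subst₂ Move (sym (Listₚ.map-++ liftˡ p _)) (sym (Listₚ.map-++ liftˡ p _))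
      (braid (map liftˡ p) (map liftˡ q) (liftˡ j) (liftˡ k)
        (trans (toℕ-liftˡ k) (trans next (cong suc (sym (toℕ-liftˡ j))))))

  move-map-liftʳ : ∀ {u v} → Move u v → Move (map liftʳ u) (map liftʳ v)
  move-map-liftʳ (commute p q j k far) =
    subst₂ Move (sym (Listₚ.map-++ liftʳ p _)) (sym (Listₚ.map-++ liftʳ p _))
      (commute (map liftʳ p) (map liftʳ q) (liftʳ j) (liftʳ k)
        (subst₂ (λ x y → suc x < y ⊎ suc y < x) (sym (toℕ-liftʳ j)) (sym (toℕ-liftʳ k)) (shift far)))
    where
    shift : ∀ {x y} → suc x < y ⊎ suc y < x → suc (a + x) < a + y ⊎ suc (a + y) < a + x
    shift {x} {y} (inj₁ x<y) = inj₁ (subst (_< a + y) (ℕₚ.+-suc a x) (ℕₚ.+-monoʳ-< a x<y))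
    shift {x} {y} (inj₂ y<x) = inj₂ (subst (_< a + x) (ℕₚ.+-suc a y) (ℕₚ.+-monoʳ-< a y<x))
  move-map-liftʳ (braid p q j k next) =
    subst₂ Move (sym (Listₚ.map-++ liftʳ p _)) (sym (Listₚ.map-++ liftʳ p _))
      (braid (map liftʳ p) (map liftʳ q) (liftʳ j) (liftʳ k)
        (trans (toℕ-liftʳ k) (trans (cong (a +_) next) (trans (ℕₚ.+-suc a _) (cong suc (sym (toℕ-liftʳ j)))))))

  walk-leftFirstˡ : ∀ {u u′ k} v → Walk u u′ k → Walk (leftFirst u v) (leftFirst u′ v) k
  walk-leftFirstˡ v = walk-map (λ u → leftFirst u v) (move-++ʳ (map liftʳ v) ∘ move-map-liftˡ)

  walk-leftFirstʳ : ∀ u {v v′ k} → Walk v v′ k → Walk (leftFirst u v) (leftFirst u v′) k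
  walk-leftFirstʳ u = walk-map (leftFirst u) (move-++ˡ (map liftˡ u) ∘ move-map-liftʳ)

  walk-rightFirstˡ : ∀ {u u′ k} v → Walk u u′ k → Walk (rightFirst u v) (rightFirst u′ v) k
  walk-rightFirstˡ v = walk-map (λ u → rightFirst u v) (move-++ˡ (map liftʳ v) ∘ move-map-liftˡ)

  walk-rightFirstʳ : ∀ u {v v′ k} → Walk v v′ k → Walk (rightFirst u v) (rightFirst u v′) k
  walk-rightFirstʳ u = walk-map (rightFirst u) (move-++ʳ (map liftˡ u) ∘ move-map-liftʳ)

  bubbleʳ : ∀ k u t → Walk (liftʳ k ∷ map liftˡ u ++ t) (map liftˡ u ++ liftʳ k ∷ t) (length u)
  bubbleʳ k []      t = here
  bubbleʳ k (j ∷ u) t = step (inj₁ (commute [] (map liftˡ u ++ t) (liftʳ k) (liftˡ j) (inj₂ (liftˡ-far-liftʳ j k))))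
                             (walk-∷ (liftˡ j) (bubbleʳ k u t))

  bubbleˡ : ∀ j v t → Walk (liftˡ j ∷ map liftʳ v ++ t) (map liftʳ v ++ liftˡ j ∷ t) (length v)
  bubbleˡ j []      t = here
  bubbleˡ j (k ∷ v) t = step (inj₁ (commute [] (map liftʳ v ++ t) (liftˡ j) (liftʳ k) (inj₁ (liftˡ-far-liftʳ j k))))
                             (walk-∷ (liftʳ k) (bubbleˡ j v t))

  private
    ifRight : Side → ℕ → ℕ
    ifRight (right _) m = m
    ifRight _         _ = 0

    ifLeft : Side → ℕ → ℕ
    ifLeft (left _) m = m
    ifLeft _        _ = 0

  rightBeforeLeft : Word (a + b) → ℕ
  rightBeforeLeft []      = 0
  rightBeforeLeft (l ∷ w) = ifRight (side l) (length (projˡ w)) + rightBeforeLeft w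

  leftBeforeRight : Word (a + b) → ℕ
  leftBeforeRight []      = 0
  leftBeforeRight (l ∷ w) = ifLeft (side l) (length (projʳ w)) + leftBeforeRight w

  sortLeftFirst : ∀ w → AvoidsMiddle w → Walk w (leftFirst (projˡ w) (projʳ w)) (rightBeforeLeft w)
  sortLeftFirst []      _ = here
  sortLeftFirst (l ∷ w) (l≢middle ∷ w-avoids) with side l | sideView l
  ... | left j  | left .j refl  = walk-∷ (liftˡ j) (sortLeftFirst w w-avoids)
  ... | middle  | _             = ⊥-elim (l≢middle refl)
  ... | right k | right .k refl = subst (Walk _ _) (ℕₚ.+-comm (rightBeforeLeft w) _)
      (walk-trans (walk-∷ (liftʳ k) (sortLeftFirst w w-avoids)) (bubbleʳ k (projˡ w) (map liftʳ (projʳ w))))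

  sortRightFirst : ∀ w → AvoidsMiddle w → Walk w (rightFirst (projˡ w) (projʳ w)) (leftBeforeRight w)
  sortRightFirst []      _ = here
  sortRightFirst (l ∷ w) (l≢middle ∷ w-avoids) with side l | sideView l
  ... | left j  | left .j refl  = subst (Walk _ _) (ℕₚ.+-comm (leftBeforeRight w) _)
      (walk-trans (walk-∷ (liftˡ j) (sortRightFirst w w-avoids)) (bubbleˡ j (projʳ w) (map liftˡ (projˡ w))))
  ... | middle  | _             = ⊥-elim (l≢middle refl)
  ... | right k | right .k refl = walk-∷ (liftʳ k) (sortRightFirst w w-avoids)

  rightBeforeLeft+leftBeforeRight : ∀ w → AvoidsMiddle w →
    rightBeforeLeft w + leftBeforeRight w ≡ length (projˡ w) * length (projʳ w)
  rightBeforeLeft+leftBeforeRight []      _ = refl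
  rightBeforeLeft+leftBeforeRight (l ∷ w) (l≢middle ∷ w-avoids) with side l
  ... | left _  = trans (solve 3 (λ x y z → x :+ (y :+ z) := y :+ (x :+ z)) refl (rightBeforeLeft w) (length (projʳ w)) _)
                        (cong (length (projʳ w) +_) (rightBeforeLeft+leftBeforeRight w w-avoids))
  ... | middle  = ⊥-elim (l≢middle refl)
  ... | right _ = trans (ℕₚ.+-assoc (length (projˡ w)) _ _)
                        (trans (cong (length (projˡ w) +_) (rightBeforeLeft+leftBeforeRight w w-avoids))
                               (sym (ℕₚ.*-suc (length (projˡ w)) _)))

  rightBeforeLeft-++ : ∀ u t → rightBeforeLeft (u ++ t) ≡ rightBeforeLeft u + length (projʳ u) * length (projˡ t) + rightBeforeLeft t
  rightBeforeLeft-++ []      t = refl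
  rightBeforeLeft-++ (l ∷ u) t with side l
  ... | left _  = rightBeforeLeft-++ u t
  ... | middle  = rightBeforeLeft-++ u t
  ... | right _ rewrite projˡ-++ u t | Listₚ.length-++ (projˡ u) {projˡ t} | rightBeforeLeft-++ u t =
    solve 5 (λ x y c z w → (x :+ y) :+ (c :+ z :* y :+ w) := (x :+ c) :+ (y :+ z :* y) :+ w) refl
      (length (projˡ u)) (length (projˡ t)) (rightBeforeLeft u) (length (projʳ u)) (rightBeforeLeft t)

  rightBeforeLeft-∷liftˡ : ∀ j w → rightBeforeLeft (liftˡ j ∷ w) ≡ rightBeforeLeft w
  rightBeforeLeft-∷liftˡ j w rewrite side-liftˡ j = refl

  rightBeforeLeft-∷liftʳ : ∀ k w → rightBeforeLeft (liftʳ k ∷ w) ≡ length (projˡ w) + rightBeforeLeft w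
  rightBeforeLeft-∷liftʳ k w rewrite side-liftʳ k = refl

  rightBeforeLeft-map-liftˡ-++ : ∀ u w → rightBeforeLeft (map liftˡ u ++ w) ≡ rightBeforeLeft w
  rightBeforeLeft-map-liftˡ-++ []      w = refl
  rightBeforeLeft-map-liftˡ-++ (j ∷ u) w = trans (rightBeforeLeft-∷liftˡ j (map liftˡ u ++ w)) (rightBeforeLeft-map-liftˡ-++ u w)

  rightBeforeLeft-map-liftʳ-++ : ∀ v w → rightBeforeLeft (map liftʳ v ++ w) ≡ length v * length (projˡ w) + rightBeforeLeft w
  rightBeforeLeft-map-liftʳ-++ []      w = refl
  rightBeforeLeft-map-liftʳ-++ (k ∷ v) w = begin
    rightBeforeLeft (liftʳ k ∷ map liftʳ v ++ w)
      ≡⟨ rightBeforeLeft-∷liftʳ k (map liftʳ v ++ w) ⟩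
    length (projˡ (map liftʳ v ++ w)) + rightBeforeLeft (map liftʳ v ++ w)
      ≡⟨ cong₂ _+_ (cong length (trans (projˡ-++ (map liftʳ v) w) (cong (_++ projˡ w) (projˡ-map-liftʳ v))))
                   (rightBeforeLeft-map-liftʳ-++ v w) ⟩
    length (projˡ w) + (length v * length (projˡ w) + rightBeforeLeft w)
      ≡⟨ ℕₚ.+-assoc (length (projˡ w)) _ _ ⟨
    length (projˡ w) + length v * length (projˡ w) + rightBeforeLeft w ∎
    where open ≡-Reasoning

  -- The shadow of one move on the two blocks: a move of α, a move of β, or
  -- an exchange of a letter of α with one of β, changing rightBeforeLeft by one.
  ProjectedStep : Word (a + b) → Word (a + b) → Set
  ProjectedStep x y =
      (Adj (projˡ x) (projˡ y) × projʳ x ≡ projʳ y × rightBeforeLeft x ≡ rightBeforeLeft y)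
    ⊎ (projˡ x ≡ projˡ y × Adj (projʳ x) (projʳ y) × rightBeforeLeft x ≡ rightBeforeLeft y)
    ⊎ (projˡ x ≡ projˡ y × projʳ x ≡ projʳ y ×
       rightBeforeLeft y ≤ suc (rightBeforeLeft x) × rightBeforeLeft x ≤ suc (rightBeforeLeft y))

  projectedStep-sym : ∀ {x y} → ProjectedStep x y → ProjectedStep y x
  projectedStep-sym (inj₁ (m , eʳ , eˣ))                  = inj₁ (adj-sym m , sym eʳ , sym eˣ)
  projectedStep-sym (inj₂ (inj₁ (eˡ , m , eˣ)))           = inj₂ (inj₁ (sym eˡ , adj-sym m , sym eˣ))
  projectedStep-sym (inj₂ (inj₂ (eˡ , eʳ , y≤x , x≤y)))   = inj₂ (inj₂ (sym eˡ , sym eʳ , x≤y , y≤x))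

  private
    projectedStep-lengthˡ : ∀ {x y} → ProjectedStep x y → length (projˡ x) ≡ length (projˡ y)
    projectedStep-lengthˡ (inj₁ (m , _))               = adj-length m
    projectedStep-lengthˡ (inj₂ (inj₁ (eˡ , _)))       = cong length eˡ
    projectedStep-lengthˡ (inj₂ (inj₂ (eˡ , _)))       = cong length eˡ

  projectedStep-++ˡ : ∀ u {x y} → ProjectedStep x y → ProjectedStep (u ++ x) (u ++ y)
  projectedStep-++ˡ u {x} {y} shadow = prefixed shadow
    where
    c = rightBeforeLeft u + length (projʳ u) * length (projˡ x)

    rbl-x : rightBeforeLeft (u ++ x) ≡ c + rightBeforeLeft x
    rbl-x = rightBeforeLeft-++ u x

    rbl-y : rightBeforeLeft (u ++ y) ≡ c + rightBeforeLeft y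
    rbl-y = trans (rightBeforeLeft-++ u y)
      (cong (λ L → rightBeforeLeft u + length (projʳ u) * L + rightBeforeLeft y) (sym (projectedStep-lengthˡ {x} {y} shadow)))

    crossing-cong : rightBeforeLeft x ≡ rightBeforeLeft y → rightBeforeLeft (u ++ x) ≡ rightBeforeLeft (u ++ y)
    crossing-cong e = trans rbl-x (trans (cong (c +_) e) (sym rbl-y))

    crossing-≤ : ∀ {z z′} → rightBeforeLeft (u ++ z) ≡ c + rightBeforeLeft z → rightBeforeLeft (u ++ z′) ≡ c + rightBeforeLeft z′ →
                 rightBeforeLeft z ≤ suc (rightBeforeLeft z′) → rightBeforeLeft (u ++ z) ≤ suc (rightBeforeLeft (u ++ z′))
    crossing-≤ {z} {z′} ez ez′ z≤z′ = begin
      rightBeforeLeft (u ++ z)        ≡⟨ ez ⟩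
      c + rightBeforeLeft z           ≤⟨ ℕₚ.+-monoʳ-≤ c z≤z′ ⟩
      c + suc (rightBeforeLeft z′)    ≡⟨ ℕₚ.+-suc c _ ⟩
      suc (c + rightBeforeLeft z′)    ≡⟨ cong suc ez′ ⟨
      suc (rightBeforeLeft (u ++ z′)) ∎
      where open ℕₚ.≤-Reasoning

    projˡ-++-cong : projˡ x ≡ projˡ y → projˡ (u ++ x) ≡ projˡ (u ++ y)
    projˡ-++-cong e = trans (projˡ-++ u x) (trans (cong (projˡ u ++_) e) (sym (projˡ-++ u y)))

    projʳ-++-cong : projʳ x ≡ projʳ y → projʳ (u ++ x) ≡ projʳ (u ++ y)
    projʳ-++-cong e = trans (projʳ-++ u x) (trans (cong (projʳ u ++_) e) (sym (projʳ-++ u y)))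

    adjˡ : Adj (projˡ x) (projˡ y) → Adj (projˡ (u ++ x)) (projˡ (u ++ y))
    adjˡ m = subst₂ Adj (sym (projˡ-++ u x)) (sym (projˡ-++ u y)) (adj-++ˡ (projˡ u) m)

    adjʳ : Adj (projʳ x) (projʳ y) → Adj (projʳ (u ++ x)) (projʳ (u ++ y))
    adjʳ m = subst₂ Adj (sym (projʳ-++ u x)) (sym (projʳ-++ u y)) (adj-++ˡ (projʳ u) m)

    prefixed : ProjectedStep x y → ProjectedStep (u ++ x) (u ++ y)
    prefixed (inj₁ (m , eʳ , eˣ))                = inj₁ (adjˡ m , projʳ-++-cong eʳ , crossing-cong eˣ)
    prefixed (inj₂ (inj₁ (eˡ , m , eˣ)))         = inj₂ (inj₁ (projˡ-++-cong eˡ , adjʳ m , crossing-cong eˣ))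
    prefixed (inj₂ (inj₂ (eˡ , eʳ , y≤x , x≤y))) =
      inj₂ (inj₂ (projˡ-++-cong eˡ , projʳ-++-cong eʳ , crossing-≤ rbl-y rbl-x y≤x , crossing-≤ rbl-x rbl-y x≤y))

  private
    Far : ∀ {n} → Letter n → Letter n → Set
    Far j k = suc (toℕ (idx j)) < toℕ (idx k) ⊎ suc (toℕ (idx k)) < toℕ (idx j)

    far-unliftˡ : ∀ {j k} → Far (liftˡ j) (liftˡ k) → Far j k
    far-unliftˡ {j} {k} = subst₂ (λ x y → suc x < y ⊎ suc y < x) (toℕ-liftˡ j) (toℕ-liftˡ k)

    far-unliftʳ : ∀ {j k} → Far (liftʳ j) (liftʳ k) → Far j k
    far-unliftʳ {j} {k} far = unshift (subst₂ (λ x y → suc x < y ⊎ suc y < x) (toℕ-liftʳ j) (toℕ-liftʳ k) far)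
      where
      unshift : ∀ {x y} → suc (a + x) < a + y ⊎ suc (a + y) < a + x → suc x < y ⊎ suc y < x
      unshift {x} {y} (inj₁ x<y) = inj₁ (ℕₚ.+-cancelˡ-< a _ _ (subst (_< a + y) (sym (ℕₚ.+-suc a x)) x<y))
      unshift {x} {y} (inj₂ y<x) = inj₂ (ℕₚ.+-cancelˡ-< a _ _ (subst (_< a + x) (sym (ℕₚ.+-suc a y)) y<x))

    data Lifted (l : Letter (a + b)) : Set where
      fromˡ : ∀ j → l ≡ liftˡ j → Lifted l
      fromʳ : ∀ k → l ≡ liftʳ k → Lifted l

    lifted : ∀ l → side l ≢ middle → Lifted l
    lifted l l≢middle with side l | sideView l
    ... | left j  | left .j e  = fromˡ j e
    ... | middle  | _          = ⊥-elim (l≢middle refl)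
    ... | right k | right .k e = fromʳ k e

    commuteStep : ∀ j k v → side j ≢ middle → side k ≢ middle → Far j k → ProjectedStep (j ∷ k ∷ v) (k ∷ j ∷ v)
    commuteStep j k v j≢middle k≢middle far with lifted j j≢middle | lifted k k≢middle
    ... | fromˡ j′ refl | fromˡ k′ refl rewrite side-liftˡ j′ | side-liftˡ k′ =
      inj₁ (inj₁ (commute [] (projˡ v) j′ k′ (far-unliftˡ far)) , refl , refl)
    ... | fromʳ j′ refl | fromʳ k′ refl rewrite side-liftʳ j′ | side-liftʳ k′ =
      inj₂ (inj₁ (refl , inj₁ (commute [] (projʳ v) j′ k′ (far-unliftʳ far)) , refl))
    ... | fromˡ j′ refl | fromʳ k′ refl rewrite side-liftˡ j′ | side-liftʳ k′ =
      inj₂ (inj₂ (refl , refl , ℕₚ.≤-refl , ℕₚ.m≤n⇒m≤1+n (ℕₚ.n≤1+n _)))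
    ... | fromʳ j′ refl | fromˡ k′ refl rewrite side-liftʳ j′ | side-liftˡ k′ =
      inj₂ (inj₂ (refl , refl , ℕₚ.m≤n⇒m≤1+n (ℕₚ.n≤1+n _) , ℕₚ.≤-refl))

    braidStep : ∀ j k v → side j ≢ middle → side k ≢ middle → toℕ (idx k) ≡ suc (toℕ (idx j)) →
                ProjectedStep (j ∷ k ∷ j ∷ v) (k ∷ j ∷ k ∷ v)
    braidStep j k v j≢middle k≢middle next with lifted j j≢middle | lifted k k≢middle
    ... | fromˡ j′ refl | fromˡ k′ refl rewrite side-liftˡ j′ | side-liftˡ k′ =
      inj₁ (inj₁ (braid [] (projˡ v) j′ k′ (trans (sym (toℕ-liftˡ k′)) (trans next (cong suc (toℕ-liftˡ j′))))) , refl , refl)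
    ... | fromʳ j′ refl | fromʳ k′ refl rewrite side-liftʳ j′ | side-liftʳ k′ =
      inj₂ (inj₁ (refl , inj₁ (braid [] (projʳ v) j′ k′ (ℕₚ.+-cancelˡ-≡ a _ _ (trans (sym (toℕ-liftʳ k′))
                                 (trans next (trans (cong suc (toℕ-liftʳ j′)) (sym (ℕₚ.+-suc a _))))))) , refl))
    ... | fromˡ j′ refl | fromʳ k′ refl =
      ⊥-elim (ℕₚ.<⇒≢ (ℕₚ.<-≤-trans (liftˡ-below j′) (liftʳ-above k′)) (sym next))
    ... | fromʳ j′ refl | fromˡ k′ refl =
      ⊥-elim (ℕₚ.<⇒≱ (liftˡ-below k′) (ℕₚ.m≤n⇒m≤1+n (ℕₚ.≤-trans (liftʳ-above j′) (ℕₚ.≤-trans (ℕₚ.n≤1+n _) (ℕₚ.≤-reflexive (sym next))))))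

  move⇒projectedStep : ∀ {x y} → Move x y → AvoidsMiddle x → ProjectedStep x y
  move⇒projectedStep (commute u v j k far) x-avoids with Allₚ.++⁻ u x-avoids
  ... | _ , j≢middle ∷ k≢middle ∷ _ =
    projectedStep-++ˡ u {j ∷ k ∷ v} {k ∷ j ∷ v} (commuteStep j k v j≢middle k≢middle far)
  move⇒projectedStep (braid u v j k next) x-avoids with Allₚ.++⁻ u x-avoids
  ... | _ , j≢middle ∷ k≢middle ∷ _ =
    projectedStep-++ˡ u {j ∷ k ∷ j ∷ v} {k ∷ j ∷ k ∷ v} (braidStep j k v j≢middle k≢middle next)

  adj⇒projectedStep : ∀ {x y} → Adj x y → AvoidsMiddle x → ProjectedStep x y
  adj⇒projectedStep     (inj₁ m) x-avoids = move⇒projectedStep m x-avoids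
  adj⇒projectedStep {x} {y} (inj₂ m) x-avoids = projectedStep-sym {y} {x} (move⇒projectedStep m (move-All⁻ m x-avoids))

  record ProjectedWalk (x y : Word (a + b)) (k : ℕ) : Set where
    field
      stepsˡ stepsʳ stepsˣ : ℕ
      walkˡ : Walk (projˡ x) (projˡ y) stepsˡ
      walkʳ : Walk (projʳ x) (projʳ y) stepsʳ
      crossing-bound : rightBeforeLeft y ≤ rightBeforeLeft x + stepsˣ
      steps-total : stepsˡ + stepsʳ + stepsˣ ≡ k

  project : ∀ {x y k} → AvoidsMiddle x → Walk x y k → ProjectedWalk x y k
  project x-avoids here = record
    { stepsˡ = 0 ; stepsʳ = 0 ; stepsˣ = 0 ; walkˡ = here ; walkʳ = here
    ; crossing-bound = ℕₚ.≤-reflexive (sym (ℕₚ.+-identityʳ _)) ; steps-total = refl }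
  project {x} x-avoids (step {u = u} e rest) =
    extend (adj⇒projectedStep {x} {u} e x-avoids) (project (adj-All e x-avoids) rest)
    where
    extend : ∀ {y k} → ProjectedStep x u → ProjectedWalk u y k → ProjectedWalk x y (suc k)
    extend (inj₁ (m , eʳ , eˣ)) p = record
      { stepsˡ = suc stepsˡ ; stepsʳ = stepsʳ ; stepsˣ = stepsˣ
      ; walkˡ = step m walkˡ ; walkʳ = subst (λ z → Walk z _ _) (sym eʳ) walkʳ
      ; crossing-bound = subst (λ c → _ ≤ c + stepsˣ) (sym eˣ) crossing-bound
      ; steps-total = cong suc steps-total }
      where open ProjectedWalk p
    extend (inj₂ (inj₁ (eˡ , m , eˣ))) p = record
      { stepsˡ = stepsˡ ; stepsʳ = suc stepsʳ ; stepsˣ = stepsˣ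
      ; walkˡ = subst (λ z → Walk z _ _) (sym eˡ) walkˡ ; walkʳ = step m walkʳ
      ; crossing-bound = subst (λ c → _ ≤ c + stepsˣ) (sym eˣ) crossing-bound
      ; steps-total = trans (cong (_+ stepsˣ) (ℕₚ.+-suc stepsˡ stepsʳ)) (cong suc steps-total) }
      where open ProjectedWalk p
    extend (inj₂ (inj₂ (eˡ , eʳ , u≤x , _))) p = record
      { stepsˡ = stepsˡ ; stepsʳ = stepsʳ ; stepsˣ = suc stepsˣ
      ; walkˡ = subst (λ z → Walk z _ _) (sym eˡ) walkˡ ; walkʳ = subst (λ z → Walk z _ _) (sym eʳ) walkʳ
      ; crossing-bound = ℕₚ.≤-trans crossing-bound (ℕₚ.≤-trans (ℕₚ.+-monoˡ-≤ stepsˣ u≤x) (ℕₚ.≤-reflexive (sym (ℕₚ.+-suc _ stepsˣ))))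
      ; steps-total = trans (ℕₚ.+-suc (stepsˡ + stepsʳ) stepsˣ) (cong suc steps-total) }
      where open ProjectedWalk p

  rightBeforeLeft-leftFirst : ∀ u v → rightBeforeLeft (leftFirst u v) ≡ 0
  rightBeforeLeft-leftFirst u v = begin
    rightBeforeLeft (map liftˡ u ++ map liftʳ v)       ≡⟨ rightBeforeLeft-map-liftˡ-++ u (map liftʳ v) ⟩
    rightBeforeLeft (map liftʳ v)                       ≡⟨ cong rightBeforeLeft (Listₚ.++-identityʳ (map liftʳ v)) ⟨
    rightBeforeLeft (map liftʳ v ++ [])                 ≡⟨ rightBeforeLeft-map-liftʳ-++ v [] ⟩
    length v * 0 + 0                                    ≡⟨ cong (_+ 0) (ℕₚ.*-zeroʳ (length v)) ⟩
    0                                                   ∎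
    where open ≡-Reasoning

  rightBeforeLeft-rightFirst : ∀ u v → rightBeforeLeft (rightFirst u v) ≡ length v * length u
  rightBeforeLeft-rightFirst u v = begin
    rightBeforeLeft (map liftʳ v ++ map liftˡ u)                       ≡⟨ rightBeforeLeft-map-liftʳ-++ v (map liftˡ u) ⟩
    length v * length (projˡ (map liftˡ u)) + rightBeforeLeft (map liftˡ u)
      ≡⟨ cong₂ (λ p r → length v * length p + r) (projˡ-map-liftˡ u)
               (trans (cong rightBeforeLeft (sym (Listₚ.++-identityʳ (map liftˡ u)))) (rightBeforeLeft-map-liftˡ-++ u [])) ⟩
    length v * length u + 0                                            ≡⟨ ℕₚ.+-identityʳ _ ⟩
    length v * length u                                                ∎
    where open ≡-Reasoning

  private
    detour-≤ : ∀ c c′ {x y X Y L} → x ≤ X → y ≤ Y → c + c′ ≤ L → c + (x + (y + c′)) ≤ X + Y + L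
    detour-≤ c c′ {x} {y} x≤X y≤Y c+c′≤L = begin
      c + (x + (y + c′)) ≡⟨ solve 4 (λ c c′ x y → c :+ (x :+ (y :+ c′)) := x :+ y :+ (c :+ c′)) refl c c′ x y ⟩
      x + y + (c + c′)   ≤⟨ ℕₚ.+-mono-≤ (ℕₚ.+-mono-≤ x≤X y≤Y) c+c′≤L ⟩
      _                  ∎
      where open ℕₚ.≤-Reasoning

    complement-≤ : ∀ x x′ y y′ {L} → x + x′ ≡ L → y + y′ ≡ L → ¬ (x + y ≤ L) → x′ + y′ ≤ L
    complement-≤ x x′ y y′ {L} x+x′≡L y+y′≡L x+y≰L = ℕₚ.≮⇒≥ λ L<x′+y′ →
      ℕₚ.<-irrefl (sym twice) (ℕₚ.+-mono-< (ℕₚ.≰⇒> x+y≰L) L<x′+y′)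
      where
      twice : (x + y) + (x′ + y′) ≡ L + L
      twice = trans (solve 4 (λ x x′ y y′ → (x :+ y) :+ (x′ :+ y′) := (x :+ x′) :+ (y :+ y′)) refl x x′ y y′)
                    (cong₂ _+_ x+x′≡L y+y′≡L)

  module _ {α : Perm a} {β : Perm b} {dα dβ : ℕ} (Dα : IsDiam α dα) (Dβ : IsDiam β dβ) where

    private
      π = dsum α β
      L = inversions α * inversions β

      crossings-sum : ∀ w → IsReduced π w → rightBeforeLeft w + leftBeforeRight w ≡ L
      crossings-sum w r = trans (rightBeforeLeft+leftBeforeRight w (reduced⇒avoidsMiddle α β w r))
        (cong₂ _*_ (reduced⇒length≡inversions (projˡ w) (reduced-projˡ α β w r)) (reduced⇒length≡inversions (projʳ w) (reduced-projʳ α β w r)))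

    -- Sort both words into blocks (left block first or right block first,
    -- whichever costs fewer exchanges), then move inside each block.
    dsum-walk≤ : ∀ w w′ → IsReduced π w → IsReduced π w′ → ∃[ k ] (k ≤ dα + dβ + L × Walk w w′ k)
    dsum-walk≤ w w′ r r′ with proj₁ Dα (projˡ w) (projˡ w′) (reduced-projˡ α β w r) (reduced-projˡ α β w′ r′)
                            | proj₁ Dβ (projʳ w) (projʳ w′) (reduced-projʳ α β w r) (reduced-projʳ α β w′ r′)
    ... | kα , kα≤dα , pα | kβ , kβ≤dβ , pβ with rightBeforeLeft w + rightBeforeLeft w′ ℕₚ.≤? L
    ...   | yes few  = _ , detour-≤ (rightBeforeLeft w) (rightBeforeLeft w′) kα≤dα kβ≤dβ few , viaLeftFirst
      where
      avoids = reduced⇒avoidsMiddle α β w r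
      avoids′ = reduced⇒avoidsMiddle α β w′ r′
      viaLeftFirst : Walk w w′ (rightBeforeLeft w + (kα + (kβ + rightBeforeLeft w′)))
      viaLeftFirst = walk-trans (sortLeftFirst w avoids) (walk-trans (walk-leftFirstˡ (projʳ w) pα)
                       (walk-trans (walk-leftFirstʳ (projˡ w′) pβ) (walk-sym (sortLeftFirst w′ avoids′))))
    ...   | no many = _ , ℕₚ.≤-trans (detour-≤ (leftBeforeRight w) (leftBeforeRight w′) kβ≤dβ kα≤dα few′) (ℕₚ.≤-reflexive (cong (_+ L) (ℕₚ.+-comm dβ dα))) , viaRightFirst
      where
      avoids = reduced⇒avoidsMiddle α β w r
      avoids′ = reduced⇒avoidsMiddle α β w′ r′
      few′ : leftBeforeRight w + leftBeforeRight w′ ≤ L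
      few′ = complement-≤ (rightBeforeLeft w) (leftBeforeRight w) (rightBeforeLeft w′) (leftBeforeRight w′) (crossings-sum w r) (crossings-sum w′ r′) many
      viaRightFirst : Walk w w′ (leftBeforeRight w + (kβ + (kα + leftBeforeRight w′)))
      viaRightFirst = walk-trans (sortRightFirst w avoids) (walk-trans (walk-rightFirstʳ (projˡ w) pβ)
                        (walk-trans (walk-rightFirstˡ (projʳ w′) pα) (walk-sym (sortRightFirst w′ avoids′))))

    -- Diametral pairs of α and β, concatenated in opposite block orders: every
    -- letter of α must cross every letter of β.
    dsum-farPair : ∃[ w ] ∃[ w′ ] (IsReduced π w × IsReduced π w′ × (∀ k → Walk w w′ k → dα + dβ + L ≤ k))
    dsum-farPair with proj₂ Dα | proj₂ Dβ
    ... | uα , uα′ , rα , rα′ , farα | uβ , uβ′ , rβ , rβ′ , farβ =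
      leftFirst uα uβ , rightFirst uα′ uβ′ , reduced-leftFirst α β uα uβ rα rβ , reduced-rightFirst α β uα′ uβ′ rα′ rβ′ , far
      where
      far : ∀ k → Walk (leftFirst uα uβ) (rightFirst uα′ uβ′) k → dα + dβ + L ≤ k
      far k p = begin
        dα + dβ + L              ≤⟨ ℕₚ.+-mono-≤ (ℕₚ.+-mono-≤ (farα stepsˡ (subst₂ (λ x y → Walk x y stepsˡ) (projˡ-leftFirst uα uβ) (projˡ-rightFirst uα′ uβ′) walkˡ))
                                                          (farβ stepsʳ (subst₂ (λ x y → Walk x y stepsʳ) (projʳ-leftFirst uα uβ) (projʳ-rightFirst uα′ uβ′) walkʳ)))
                                               crossed ⟩
        stepsˡ + stepsʳ + stepsˣ ≡⟨ steps-total ⟩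
        k                        ∎
        where
        open ℕₚ.≤-Reasoning
        open ProjectedWalk (project (avoidsMiddle-leftFirst uα uβ) p)
        crossed : L ≤ stepsˣ
        crossed = begin
          inversions α * inversions β                  ≡⟨ cong₂ _*_ (reduced⇒length≡inversions uα′ rα′) (reduced⇒length≡inversions uβ′ rβ′) ⟨
          length uα′ * length uβ′                      ≡⟨ ℕₚ.*-comm (length uα′) (length uβ′) ⟩
          length uβ′ * length uα′                      ≡⟨ rightBeforeLeft-rightFirst uα′ uβ′ ⟨
          rightBeforeLeft (rightFirst uα′ uβ′)         ≤⟨ crossing-bound ⟩
          rightBeforeLeft (leftFirst uα uβ) + stepsˣ   ≡⟨ cong (_+ stepsˣ) (rightBeforeLeft-leftFirst uα uβ) ⟩
          stepsˣ                                       ∎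

    isDiam-dsum : IsDiam π (dα + dβ + L)
    isDiam-dsum = dsum-walk≤ , dsum-farPair

  -- Inversion patterns of a direct sum

  pairˡ : Fin a × Fin a → Fin (a + b) × Fin (a + b)
  pairˡ (x , y) = x ↑ˡ b , y ↑ˡ b

  pairʳ : Fin b × Fin b → Fin (a + b) × Fin (a + b)
  pairʳ (z , z′) = a ↑ʳ z , a ↑ʳ z′

  allFin-+ : allFin (a + b) ≡ map (_↑ˡ b) (allFin a) ++ map (a ↑ʳ_) (allFin b)
  allFin-+ = trans (tabulate-+ a (λ i → i))
    (sym (cong₂ _++_ (Listₚ.map-tabulate (λ i → i) (_↑ˡ b)) (Listₚ.map-tabulate (λ i → i) (a ↑ʳ_))))
    where
    tabulate-+ : ∀ {X : Set} c (f : Fin (c + b) → X) → tabulate f ≡ tabulate (f ∘ (_↑ˡ b)) ++ tabulate (f ∘ (c ↑ʳ_))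
    tabulate-+ zero    f = refl
    tabulate-+ (suc c) f = cong (f Fin.zero ∷_) (tabulate-+ c (f ∘ Fin.suc))

  module _ {P : Pred (Fin (a + b) × Fin (a + b)) 0ℓ} {Pˡ : Pred (Fin a × Fin a) 0ℓ} {Pʳ : Pred (Fin b × Fin b) 0ℓ}
           (P? : Decidable P) (Pˡ? : Decidable Pˡ) (Pʳ? : Decidable Pʳ)
           (ˡˡ : ∀ x y → does (P? (x ↑ˡ b , y ↑ˡ b)) ≡ does (Pˡ? (x , y)))
           (ˡʳ : ∀ x z → does (P? (x ↑ˡ b , a ↑ʳ z)) ≡ false)
           (ʳˡ : ∀ z x → does (P? (a ↑ʳ z , x ↑ˡ b)) ≡ false)
           (ʳʳ : ∀ z z′ → does (P? (a ↑ʳ z , a ↑ʳ z′)) ≡ does (Pʳ? (z , z′))) where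

    private
      row : ∀ {n} → Fin n → List (Fin n × Fin n)
      row {n} i = map (i ,_) (allFin n)

      filter-row : ∀ i → filter P? (row i) ≡ filter P? (map (λ x → i , x ↑ˡ b) (allFin a)) ++ filter P? (map (λ z → i , a ↑ʳ z) (allFin b))
      filter-row i = begin
        filter P? (map (i ,_) (allFin (a + b)))
          ≡⟨ cong (filter P? ∘ map (i ,_)) allFin-+ ⟩
        filter P? (map (i ,_) (map (_↑ˡ b) (allFin a) ++ map (a ↑ʳ_) (allFin b)))
          ≡⟨ cong (filter P?) (Listₚ.map-++ (i ,_) (map (_↑ˡ b) (allFin a)) _) ⟩
        filter P? (map (i ,_) (map (_↑ˡ b) (allFin a)) ++ map (i ,_) (map (a ↑ʳ_) (allFin b)))
          ≡⟨ Listₚ.filter-++ P? (map (i ,_) (map (_↑ˡ b) (allFin a))) _ ⟩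
        filter P? (map (i ,_) (map (_↑ˡ b) (allFin a))) ++ filter P? (map (i ,_) (map (a ↑ʳ_) (allFin b)))
          ≡⟨ cong₂ (λ u v → filter P? u ++ filter P? v) (Listₚ.map-∘ (allFin a)) (Listₚ.map-∘ (allFin b)) ⟨
        filter P? (map (λ x → i , x ↑ˡ b) (allFin a)) ++ filter P? (map (λ z → i , a ↑ʳ z) (allFin b)) ∎
        where open ≡-Reasoning

      filter-rowˡ : ∀ x → filter P? (row (x ↑ˡ b)) ≡ map pairˡ (filter Pˡ? (row x))
      filter-rowˡ x = trans (filter-row (x ↑ˡ b)) (trans (cong₂ _++_
        (trans (cong (filter P?) (Listₚ.map-∘ {g = pairˡ} {f = x ,_} (allFin a)))
               (filter-map P? Pˡ? pairˡ (λ (y , y′) → ˡˡ y y′) (row x)))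
        (filter-map-none P? (λ z → x ↑ˡ b , a ↑ʳ z) (ˡʳ x) (allFin b))) (Listₚ.++-identityʳ _))

      filter-rowʳ : ∀ z → filter P? (row (a ↑ʳ z)) ≡ map pairʳ (filter Pʳ? (row z))
      filter-rowʳ z = trans (filter-row (a ↑ʳ z)) (cong₂ _++_
        (filter-map-none P? (λ x → a ↑ʳ z , x ↑ˡ b) (ʳˡ z) (allFin a))
        (trans (cong (filter P?) (Listₚ.map-∘ {g = pairʳ} {f = z ,_} (allFin b)))
               (filter-map P? Pʳ? pairʳ (λ (y , y′) → ʳʳ y y′) (row z))))

    filter-pairs-+ : filter P? (pairs (a + b)) ≡ map pairˡ (filter Pˡ? (pairs a)) ++ map pairʳ (filter Pʳ? (pairs b))
    filter-pairs-+ = begin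
      filter P? (concatMap row (allFin (a + b)))
        ≡⟨ filter-concatMap P? row (allFin (a + b)) ⟩
      concatMap (filter P? ∘ row) (allFin (a + b))
        ≡⟨ cong (concatMap (filter P? ∘ row)) allFin-+ ⟩
      concatMap (filter P? ∘ row) (map (_↑ˡ b) (allFin a) ++ map (a ↑ʳ_) (allFin b))
        ≡⟨ Listₚ.concatMap-++ (filter P? ∘ row) (map (_↑ˡ b) (allFin a)) _ ⟩
      concatMap (filter P? ∘ row) (map (_↑ˡ b) (allFin a)) ++ concatMap (filter P? ∘ row) (map (a ↑ʳ_) (allFin b))
        ≡⟨ cong₂ _++_ (Listₚ.concatMap-map (filter P? ∘ row) (_↑ˡ b) (allFin a)) (Listₚ.concatMap-map (filter P? ∘ row) (a ↑ʳ_) (allFin b)) ⟩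
      concatMap (filter P? ∘ row ∘ (_↑ˡ b)) (allFin a) ++ concatMap (filter P? ∘ row ∘ (a ↑ʳ_)) (allFin b)
        ≡⟨ cong₂ _++_ (Listₚ.concatMap-cong filter-rowˡ (allFin a)) (Listₚ.concatMap-cong filter-rowʳ (allFin b)) ⟩
      concatMap (map pairˡ ∘ filter Pˡ? ∘ row) (allFin a) ++ concatMap (map pairʳ ∘ filter Pʳ? ∘ row) (allFin b)
        ≡⟨ cong₂ _++_ (Listₚ.map-concatMap pairˡ (filter Pˡ? ∘ row) (allFin a)) (Listₚ.map-concatMap pairʳ (filter Pʳ? ∘ row) (allFin b)) ⟨
      map pairˡ (concatMap (filter Pˡ? ∘ row) (allFin a)) ++ map pairʳ (concatMap (filter Pʳ? ∘ row) (allFin b))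
        ≡⟨ cong₂ (λ u v → map pairˡ u ++ map pairʳ v) (filter-concatMap Pˡ? row (allFin a)) (filter-concatMap Pʳ? row (allFin b)) ⟨
      map pairˡ (filter Pˡ? (pairs a)) ++ map pairʳ (filter Pʳ? (pairs b)) ∎
      where open ≡-Reasoning

  module _ {D : Pred ((Fin (a + b) × Fin (a + b)) × (Fin (a + b) × Fin (a + b))) 0ℓ}
           {Dˡ : Pred ((Fin a × Fin a) × (Fin a × Fin a)) 0ℓ} {Dʳ : Pred ((Fin b × Fin b) × (Fin b × Fin b)) 0ℓ}
           (D? : Decidable D) (Dˡ? : Decidable Dˡ) (Dʳ? : Decidable Dʳ)
           (agreeˡ : ∀ p q → does (D? (pairˡ p , pairˡ q)) ≡ does (Dˡ? (p , q)))
           (agreeʳ : ∀ p q → does (D? (pairʳ p , pairʳ q)) ≡ does (Dʳ? (p , q)))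
           (across : ∀ p q → does (D? (pairˡ p , pairʳ q)) ≡ true) where

    length-filter-unorderedPairs-blocks : ∀ xs ys →
      length (filter D? (unorderedPairs (map pairˡ xs ++ map pairʳ ys)))
        ≡ length (filter Dˡ? (unorderedPairs xs)) + length (filter Dʳ? (unorderedPairs ys)) + length xs * length ys
    length-filter-unorderedPairs-blocks xs ys = begin
      count (unorderedPairs (map pairˡ xs ++ map pairʳ ys))
        ≡⟨ length-filter-unorderedPairs-++ D? (map pairˡ xs) (map pairʳ ys) ⟩
      count (unorderedPairs (map pairˡ xs)) + count (unorderedPairs (map pairʳ ys)) + count (crossPairs (map pairˡ xs))
        ≡⟨ cong₂ _+_ (cong₂ _+_ (countBlock pairˡ Dˡ? agreeˡ xs) (countBlock pairʳ Dʳ? agreeʳ ys)) (crossing xs) ⟩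
      length (filter Dˡ? (unorderedPairs xs)) + length (filter Dʳ? (unorderedPairs ys)) + length xs * length ys ∎
      where
      open ≡-Reasoning
      count = length ∘ filter D?

      crossPairs : List (Fin (a + b) × Fin (a + b)) → List _
      crossPairs us = concatMap (λ u → map (u ,_) (map pairʳ ys)) us

      countBlock : ∀ {c} (pair : Fin c × Fin c → Fin (a + b) × Fin (a + b)) {E : Pred ((Fin c × Fin c) × (Fin c × Fin c)) 0ℓ}
              (E? : Decidable E) → (∀ p q → does (D? (pair p , pair q)) ≡ does (E? (p , q))) →
              ∀ zs → count (unorderedPairs (map pair zs)) ≡ length (filter E? (unorderedPairs zs))
      countBlock pair E? agree zs = trans (cong count (unorderedPairs-map pair zs))
                                     (length-filter-map D? E? (Prod.map pair pair) (λ (p , q) → agree p q) (unorderedPairs zs))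

      crossing : ∀ xs → count (crossPairs (map pairˡ xs)) ≡ length xs * length ys
      crossing []       = refl
      crossing (x ∷ xs) = trans (length-filter-++ D? (map (pairˡ x ,_) (map pairʳ ys)) _)
        (cong₂ _+_ (trans (cong count (sym (Listₚ.map-∘ ys))) (length-filter-map-all D? (λ y → pairˡ x , pairʳ y) (across x) ys))
                   (crossing xs))

  module _ (α : Perm a) (β : Perm b) where

    private
      π = dsum α β

    Inv-dsum : Inv π ≡ map pairˡ (Inv α) ++ map pairʳ (Inv β)
    Inv-dsum = filter-pairs-+ _ _ _ (isInversion-↑ˡ↑ˡ α β) (isInversion-↑ˡ↑ʳ α β) (isInversion-↑ʳ↑ˡ α β) (isInversion-↑ʳ↑ʳ α β)

    private
      disjoint-cong : ∀ {u₁ u₂ u₃ u₄ v₁ v₂ v₃ v₄} → u₁ ≡ v₁ → u₂ ≡ v₂ → u₃ ≡ v₃ → u₄ ≡ v₄ →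
                      not u₁ ∧ (not u₂ ∧ (not u₃ ∧ not u₄)) ≡ not v₁ ∧ (not v₂ ∧ (not v₃ ∧ not v₄))
      disjoint-cong refl refl refl refl = refl

      disjoint-true : ∀ {u₁ u₂ u₃ u₄} → u₁ ≡ false → u₂ ≡ false → u₃ ≡ false → u₄ ≡ false →
                      not u₁ ∧ (not u₂ ∧ (not u₃ ∧ not u₄)) ≡ true
      disjoint-true refl refl refl refl = refl

      ↑ˡ≟↑ʳ : ∀ x z → does (x ↑ˡ b Finₚ.≟ a ↑ʳ z) ≡ false
      ↑ˡ≟↑ʳ x z = dec-false (x ↑ˡ b Finₚ.≟ a ↑ʳ z) (↑ˡ≢↑ʳ x z)

      ≟-↑ˡ : ∀ (x y : Fin a) → does (x ↑ˡ b Finₚ.≟ y ↑ˡ b) ≡ does (x Finₚ.≟ y)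
      ≟-↑ˡ = does-≟-injective (_↑ˡ b) (λ {x} {y} → Finₚ.↑ˡ-injective b x y)

      ≟-↑ʳ : ∀ (z z′ : Fin b) → does (a ↑ʳ z Finₚ.≟ a ↑ʳ z′) ≡ does (z Finₚ.≟ z′)
      ≟-↑ʳ = does-≟-injective (a ↑ʳ_) (λ {z} {z′} → Finₚ.↑ʳ-injective a z z′)

    length-I2-dsum : length (I2 π) ≡ length (I2 α) + length (I2 β) + length (Inv α) * length (Inv β)
    length-I2-dsum = trans (cong (λ xs → length (filter _ (unorderedPairs xs))) Inv-dsum)
      (length-filter-unorderedPairs-blocks _ _ _
        (λ { (i , j) (k , l) → disjoint-cong (≟-↑ˡ i k) (≟-↑ˡ i l) (≟-↑ˡ j k) (≟-↑ˡ j l) })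
        (λ { (i , j) (k , l) → disjoint-cong (≟-↑ʳ i k) (≟-↑ʳ i l) (≟-↑ʳ j k) (≟-↑ʳ j l) })
        (λ { (i , j) (k , l) → disjoint-true (↑ˡ≟↑ʳ i k) (↑ˡ≟↑ʳ i l) (↑ˡ≟↑ʳ j k) (↑ˡ≟↑ʳ j l) })
        (Inv α) (Inv β))

    private
      321At : Perm (a + b) → Fin (a + b) → Fin (a + b) → Fin (a + b) → ℕ
      321At σ i j k = indicator (is321 σ i j k)

      leftLeftLeft : ∀ x y w → 321At π (x ↑ˡ b) (y ↑ˡ b) (w ↑ˡ b) ≡ indicator (is321 α x y w)
      leftLeftLeft x y w = cong indicator
        (cong₂ _∧_ (↑ˡ<ᵇ↑ˡ x y) (cong₂ _∧_ (↑ˡ<ᵇ↑ˡ y w) (cong₂ _∧_ (π<ᵇ-↑ˡ↑ˡ α β y x) (π<ᵇ-↑ˡ↑ˡ α β w y))))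

      leftLeftRight : ∀ x y z → 321At π (x ↑ˡ b) (y ↑ˡ b) (a ↑ʳ z) ≡ 0
      leftLeftRight x y z = cong indicator (is321-σk<σj π (x ↑ˡ b) (y ↑ˡ b) (a ↑ʳ z) (π<ᵇ-↑ʳ↑ˡ α β z y))

      leftRight : ∀ x z k → 321At π (x ↑ˡ b) (a ↑ʳ z) k ≡ 0
      leftRight x z k = cong indicator (is321-σj<σi π (x ↑ˡ b) (a ↑ʳ z) k (π<ᵇ-↑ʳ↑ˡ α β z x))

      rightLeft : ∀ z y k → 321At π (a ↑ʳ z) (y ↑ˡ b) k ≡ 0
      rightLeft z y k = cong indicator (is321-i<j π (a ↑ʳ z) (y ↑ˡ b) k (↑ʳ<ᵇ↑ˡ z y))

      rightRightLeft : ∀ z z′ y → 321At π (a ↑ʳ z) (a ↑ʳ z′) (y ↑ˡ b) ≡ 0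
      rightRightLeft z z′ y = cong indicator (is321-j<k π (a ↑ʳ z) (a ↑ʳ z′) (y ↑ˡ b) (↑ʳ<ᵇ↑ˡ z′ y))

      rightRightRight : ∀ z z′ z″ → 321At π (a ↑ʳ z) (a ↑ʳ z′) (a ↑ʳ z″) ≡ indicator (is321 β z z′ z″)
      rightRightRight z z′ z″ = cong indicator
        (cong₂ _∧_ (↑ʳ<ᵇ↑ʳ z z′) (cong₂ _∧_ (↑ʳ<ᵇ↑ʳ z′ z″) (cong₂ _∧_ (π<ᵇ-↑ʳ↑ʳ α β z′ z) (π<ᵇ-↑ʳ↑ʳ α β z″ z′))))

    length-I3-dsum : length (I3 π) ≡ length (I3 α) + length (I3 β)
    length-I3-dsum = begin
      length (I3 π)                                              ≡⟨ length-I3 π ⟩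
      ∑[ i < a + b ] ∑[ j < a + b ] ∑[ k < a + b ] 321At π i j k ≡⟨ sum-↑ a b _ ⟩
      ∑[ x < a ] ∑[ j < a + b ] ∑[ k < a + b ] 321At π (x ↑ˡ b) j k
        + ∑[ z < b ] ∑[ j < a + b ] ∑[ k < a + b ] 321At π (a ↑ʳ z) j k
        ≡⟨ cong₂ _+_ (sum-cong-≗ fromLeft) (sum-cong-≗ fromRight) ⟩
      ∑[ x < a ] ∑[ y < a ] ∑[ w < a ] indicator (is321 α x y w)
        + ∑[ z < b ] ∑[ z′ < b ] ∑[ z″ < b ] indicator (is321 β z z′ z″)
        ≡⟨ cong₂ _+_ (length-I3 α) (length-I3 β) ⟨
      length (I3 α) + length (I3 β)                              ∎
      where
      open ≡-Reasoning
      fromLeft : ∀ x → ∑[ j < a + b ] ∑[ k < a + b ] 321At π (x ↑ˡ b) j k ≡ ∑[ y < a ] ∑[ w < a ] indicator (is321 α x y w)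
      fromLeft x = trans (sum-↑ˡ a b _ (λ z → sum-zero (leftRight x z)))
        (sum-cong-≗ λ y → trans (sum-↑ˡ a b _ (leftLeftRight x y)) (sum-cong-≗ (leftLeftLeft x y)))
      fromRight : ∀ z → ∑[ j < a + b ] ∑[ k < a + b ] 321At π (a ↑ʳ z) j k ≡ ∑[ z′ < b ] ∑[ z″ < b ] indicator (is321 β z z′ z″)
      fromRight z = trans (sum-↑ʳ a b _ (λ y → sum-zero (rightLeft z y)))
        (sum-cong-≗ λ z′ → trans (sum-↑ʳ a b _ (rightRightLeft z z′)) (sum-cong-≗ (rightRightRight z z′)))

    L2size-dsum : L2size π ≡ L2size α + L2size β + inversions α * inversions β
    L2size-dsum = begin
      length (I2 π) + length (I3 π)
        ≡⟨ cong₂ _+_ length-I2-dsum length-I3-dsum ⟩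
      length (I2 α) + length (I2 β) + length (Inv α) * length (Inv β) + (length (I3 α) + length (I3 β))
        ≡⟨ cong (λ c → length (I2 α) + length (I2 β) + c + (length (I3 α) + length (I3 β))) (cong₂ _*_ (length-Inv α) (length-Inv β)) ⟩
      length (I2 α) + length (I2 β) + c + (length (I3 α) + length (I3 β))
        ≡⟨ solve 5 (λ p q c r s → p :+ q :+ c :+ (r :+ s) := p :+ r :+ (q :+ s) :+ c) refl
             (length (I2 α)) (length (I2 β)) c (length (I3 α)) (length (I3 β)) ⟩
      L2size α + L2size β + c ∎
      where
      open ≡-Reasoning
      c = inversions α * inversions β

proposition6p3 : (a b : ℕ) (α : Perm a) (β : Perm b) → IsPerm α → IsPerm β →
    (dα dβ : ℕ) → IsDiam α dα → IsDiam β dβ →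
    L2size α ≤ 2 * dα → dα ≤ L2size α →
    L2size β ≤ 2 * dβ → dβ ≤ L2size β →
    ∃[ dπ ] (IsDiam (dsum α β) dπ ×
      L2size (dsum α β) ≤ 2 * dπ × dπ ≤ L2size (dsum α β) ×
      (dα ≡ L2size α → dβ ≡ L2size β → dπ ≡ L2size (dsum α β)))
proposition6p3 a b α β _ _ dα dβ Dα Dβ Lα≤2dα dα≤Lα Lβ≤2dβ dβ≤Lβ =
  dα + dβ + c , isDiam-dsum Dα Dβ , L≤2d , d≤L , d≡L
  where
  open DirectSum a b
  c = inversions α * inversions β

  L≤2d : L2size (dsum α β) ≤ 2 * (dα + dβ + c)
  L≤2d = begin
    L2size (dsum α β)                 ≡⟨ L2size-dsum α β ⟩
    L2size α + L2size β + c           ≤⟨ ℕₚ.+-mono-≤ (ℕₚ.+-mono-≤ Lα≤2dα Lβ≤2dβ) (ℕₚ.m≤n*m c 2) ⟩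
    2 * dα + 2 * dβ + 2 * c           ≡⟨ solve 3 (λ x y z → con 2 :* x :+ con 2 :* y :+ con 2 :* z := con 2 :* (x :+ y :+ z)) refl dα dβ c ⟩
    2 * (dα + dβ + c)                 ∎
    where open ℕₚ.≤-Reasoning

  d≤L : dα + dβ + c ≤ L2size (dsum α β)
  d≤L = ℕₚ.≤-trans (ℕₚ.+-monoˡ-≤ c (ℕₚ.+-mono-≤ dα≤Lα dβ≤Lβ)) (ℕₚ.≤-reflexive (sym (L2size-dsum α β)))

  d≡L : dα ≡ L2size α → dβ ≡ L2size β → dα + dβ + c ≡ L2size (dsum α β)
  d≡L dα≡Lα dβ≡Lβ = trans (cong₂ (λ x y → x + y + c) dα≡Lα dβ≡Lβ) (sym (L2size-dsum α β))
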